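{- Let $\mathfrak{A}$ be the family of all $k$-dimensional $M$-part Sperner multi-families on $X=X_1\uplus\cdots\uplus X_M$ with parameters $\{L_P:P\in\binom{[M]}{k}\}$ satisfying a $\Gamma$-multiplicity constraint $\mathcal{M}_\Gamma$. Then for every multiset $I$ on $\pi_M$ which is a lexicographically maximal (LEM) $k$-dimensional multi-transversal with parameters $\{L_P\}$ satisfying $\mathcal{M}_\Gamma$, the matrix $S(I)$ is an extreme point of the convex hull of $\mu(\mathfrak{A})$.
   Context: $X$ is a finite set partitioned as $X=X_1\uplus\cdots\uplus X_M$, $|X_i|=m_i\ge1$, $n_i=m_i+1$, $[n]^{\star}=\{0,\ldots,n-1\}$, $\pi_M=\prod_i[n_i]^{\star}$. Multi-families are multisets of subsets of $X$, $\#[F,\mathcal{F}]$ the multiplicity. Given $k\in[M]$ and positive integers $L_P$, a $k$-dimensional $M$-part Sperner multi-family with parameters $\{L_P\}$ is a multi-family such that for every $P\in\binom{[M]}{k}$, chains $\mathcal{C}_j$ of subsets of $X_j$ ($j\in P$) and sets $D_i\subseteq X_i$ ($i\notin P$), at most $L_P$ members (with multiplicity) satisfy $F\cap X_j\in\mathcal{C}_j$ ($j\in P$) and $F\cap X_i=D_i$ ($i\notin P$). A $k$-dimensional multi-transversal on $\pi_M$ with parameters $\{L_P\}$ is a multiset $I$ on $\pi_M$ such that for every $P$ and fixed $b_j\in[n_j]^{\star}$ ($j\notin P$) at most $L_P$ elements of $I$ (with multiplicity) have $j$-th coordinate $b_j$ for all $j\notin P$. A $\Gamma$-multiplicity constraint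 is $\mathcal{M}_\Gamma=\{(A_\gamma\ge0,\{\alpha^\gamma_v\ge0:v\in\pi_M\}):\gamma\in\Gamma\}$, $\Gamma$ finite; a multi-family $\mathcal{F}$ satisfies it if $\sum_v\alpha^\gamma_v\max\{\#[F,\mathcal{F}]:F\text{ has profile vector }v\}\le A_\gamma$ for all $\gamma$, and a multiset $I$ on $\pi_M$ satisfies it if $\sum_v\alpha^\gamma_v\#[v,I]\le A_\gamma$ for all $\gamma$ (profile vector of $F$: $(|F\cap X_1|,\ldots,|F\cap X_M|)$). Such a multi-transversal $I$ satisfying $\mathcal{M}_\Gamma$ is LEM if its support $\mathrm{supp}(I)$ has an ordering $\vec j_1,\ldots,\vec j_s$ such that for every $k$-dimensional multi-transversal $I^\star$ with parameters $\{L_P\}$ satisfying $\mathcal{M}_\Gamma$: (i) if $\vec j_1\in\mathrm{supp}(I^\star)$ then $\#[\vec j_1,I]\ge\#[\vec j_1,I^\star]$; (ii) for every $1\le\ell\le s-1$, if $\{\vec j_1,\ldots,\vec j_\ell\}\subseteq\mathrm{supp}(I^\star)$ and $\#[\vec j_h,I]=\#[\vec j_h,I^\star]$ for $h\le\ell$, then $\#[\vec j_{\ell+1},I]\ge\#[\vec j_{\ell+1},I^\star]$. The profile matrix of $\mathcal{F}$ has entry at $v\in\pi_M$ equal to the number of members with profile vector $v$ (viewed in $\mathbb{R}^{\prod n_j}$), and $\mu(\mathfrak{A})$ is the set of profile matrices of members of $\mathfrak{A}$. $S(I)$ is the matrix indexed by $\pi_M$ with entry $\#[(i_1,\ldots,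i_M),I]\prod_j\binom{m_j}{i_j}$.
   Formalization: The constraint data $A_\gamma$ and $\alpha^\gamma_v$ are rational, and the convex hull of $\mu(\mathfrak{A})$ is taken with rational coefficients and rational matrices rather than real ones. -}

module Defs where

open import Data.Nat as ℕ using (ℕ; zero; suc; _≡ᵇ_)
open import Data.Nat.Combinatorics using (_C_)
open import Data.Integer using (+_)
open import Data.Rational as ℚ using (ℚ; 0ℚ; 1ℚ)
open import Data.Bool using (Bool; true; false; if_then_else_; _∧_)
open import Data.Fin using (Fin; zero; suc; toℕ)
import Data.Fin as Fin
open import Data.Fin.Subset using (Subset; _∩_; ∣_∣; _⊆_)
open import Data.Vec using (Vec; tabulate; lookup; []; _∷_)
import Data.Vec.Properties as VecP
import Data.Bool
open import Data.List using (List; []; _∷_; map; foldr; filterᵇ; length; concatMap; allFin; _++_)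
open import Data.Bool.ListAction using (all; any)
open import Data.List.Relation.Unary.All using (All)
open import Data.List.Relation.Unary.AllPairs using (AllPairs)
open import Data.List.Relation.Unary.Unique.Propositional using (Unique)
open import Data.List.Membership.Propositional using (_∈_)
open import Data.Product using (Σ; ∃; _×_; _,_; proj₁; proj₂)
open import Data.Sum using (_⊎_)
open import Data.Unit using (⊤; tt)
open import Relation.Binary.PropositionalEquality using (_≡_)
open import Relation.Nullary.Decidable using (⌊_⌋)
open import Function using (_∘_)

ℕtoℚ : ℕ → ℚ
ℕtoℚ n = + n ℚ./ 1

sumℚ : List ℚ → ℚ
sumℚ = foldr ℚ._+_ 0ℚ

sumℕ : List ℕ → ℕ
sumℕ = foldr ℕ._+_ 0

prodℕ : List ℕ → ℕ
prodℕ = foldr ℕ._*_ 1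

maxℕ : List ℕ → ℕ
maxℕ = foldr ℕ._⊔_ 0

_==ˢ_ : ∀ {n} → Subset n → Subset n → Bool
A ==ˢ B = ⌊ VecP.≡-dec Data.Bool._≟_ A B ⌋

allSubsets : (n : ℕ) → List (Subset n)
allSubsets zero = [] ∷ []
allSubsets (suc n) = concatMap (λ A → (true ∷ A) ∷ (false ∷ A) ∷ []) (allSubsets n)

-- The ground set X = Fin N, partitioned by  part : Fin N → Fin M
-- into blocks X_i = { x | part x ≡ i }.

module _ {N M : ℕ} (part : Fin N → Fin M) where

  block : Fin M → Subset N
  block i = tabulate (λ x → ⌊ part x Fin.≟ i ⌋)

  msize : Fin M → ℕ
  msize i = ∣ block i ∣

-- π_M = ∏_i [n_i]^⋆ for a size function n (here n_i = m_i + 1),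
-- as an iterated product, with coordinate access and an enumeration.

Pi : (M : ℕ) → (Fin M → ℕ) → Set
Pi zero    n = ⊤
Pi (suc M) n = Fin (n zero) × Pi M (n ∘ suc)

coord : ∀ {M} {n : Fin M → ℕ} → Pi M n → (i : Fin M) → Fin (n i)
coord {suc M} (a , v) zero    = a
coord {suc M} (a , v) (suc i) = coord v i

allPi : (M : ℕ) (n : Fin M → ℕ) → List (Pi M n)
allPi zero    n = tt ∷ []
allPi (suc M) n =
  concatMap (λ a → map (λ v → (a , v)) (allPi M (n ∘ suc))) (allFin (n zero))

module _ {N M : ℕ} (part : Fin N → Fin M) where

  private
    m : Fin M → ℕ
    m = msize part
    X : Fin M → Subset N
    X = block part

  πM : Set
  πM = Pi M (suc ∘ m)

  allπM : List πM
  allπM = allPi M (suc ∘ m)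

  Matrix : Set
  Matrix = πM → ℚ

  hasProfile : Subset N → πM → Bool
  hasProfile F v = all (λ i → ∣ F ∩ X i ∣ ≡ᵇ toℕ (coord v i)) (allFin M)

  -- multi-families: finite multisets of subsets of X, given as lists
  MultiFamily : Set
  MultiFamily = List (Subset N)

  multF : Subset N → MultiFamily → ℕ
  multF F 𝓕 = length (filterᵇ (λ G → G ==ˢ F) 𝓕)

  -- multisets on π_M, given by their multiplicity function: #[v, I] = I v
  MultiSet : Set
  MultiSet = πM → ℕ

  IsChainIn : Fin M → List (Subset N) → Set
  IsChainIn j C = All (λ A → A ⊆ X j) C × AllPairs (λ A B → A ⊆ B ⊎ B ⊆ A) C

  IsKSet : ℕ → Subset M → Set
  IsKSet k P = ∣ P ∣ ≡ k

  IsSperner : (k : ℕ) (L : Subset M → ℕ) → MultiFamily → Set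
  IsSperner k L 𝓕 =
    (P : Subset M) → IsKSet k P →
    (C : Fin M → List (Subset N)) → ((j : Fin M) → lookup P j ≡ true → IsChainIn j (C j)) →
    (D : Fin M → Subset N) → ((i : Fin M) → lookup P i ≡ false → D i ⊆ X i) →
    length (filterᵇ (λ F → all (λ j → if lookup P j
                                          then any (λ A → (F ∩ X j) ==ˢ A) (C j)
                                          else (F ∩ X j) ==ˢ D j)
                                (allFin M)) 𝓕)
      ℕ.≤ L P

  IsMultiTransversal : (k : ℕ) (L : Subset M → ℕ) → MultiSet → Set
  IsMultiTransversal k L I =
    (P : Subset M) → IsKSet k P →
    (b : πM) →   -- only the coordinates b_j with j ∉ P are used
    sumℕ (map (λ v → if all (λ j → if lookup P j then true
                                    else ⌊ coord v j Fin.≟ coord b j ⌋) (allFin M)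
                     then I v else 0) allπM)
      ℕ.≤ L P

  -- Γ-multiplicity constraint with Γ = Fin G :  (A_γ, α^γ)
  -- multi-family satisfies it
  SatisfiesMF : {G : ℕ} → (A : Fin G → ℚ) → (α : Fin G → πM → ℚ) → MultiFamily → Set
  SatisfiesMF {G} A α 𝓕 =
    (γ : Fin G) →
    sumℚ (map (λ v → α γ v ℚ.* ℕtoℚ
                 (maxℕ (map (λ F → if hasProfile F v then multF F 𝓕 else 0)
                            (allSubsets N))))
              allπM)
      ℚ.≤ A γ

  SatisfiesMS : {G : ℕ} → (A : Fin G → ℚ) → (α : Fin G → πM → ℚ) → MultiSet → Set
  SatisfiesMS {G} A α I =
    (γ : Fin G) → sumℚ (map (λ v → α γ v ℚ.* ℕtoℚ (I v)) allπM) ℚ.≤ A γ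

  InSupp : MultiSet → πM → Set
  InSupp I v = 0 ℕ.< I v

  IsLEM : (k : ℕ) (L : Subset M → ℕ) {G : ℕ} (A : Fin G → ℚ) (α : Fin G → πM → ℚ) →
          MultiSet → Set
  IsLEM k L A α I =
    Σ (List πM) λ js →
      Unique js ×
      ((v : πM) → (v ∈ js → InSupp I v) × (InSupp I v → v ∈ js)) ×
      ((I⋆ : MultiSet) → IsMultiTransversal k L I⋆ → SatisfiesMS A α I⋆ →
        ((j : πM) (post : List πM) → js ≡ j ∷ post →
           InSupp I⋆ j → I⋆ j ℕ.≤ I j) ×
        ((pre : List πM) (j : πM) (post : List πM) → js ≡ pre ++ (j ∷ post) →
           All (λ u → InSupp I⋆ u × I u ≡ I⋆ u) pre →
           I⋆ j ℕ.≤ I j))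

  profileMatrix : MultiFamily → Matrix
  profileMatrix 𝓕 v = ℕtoℚ (length (filterᵇ (λ F → hasProfile F v) 𝓕))

  SMatrix : MultiSet → Matrix
  SMatrix I v = ℕtoℚ (I v ℕ.* prodℕ (map (λ j → m j C toℕ (coord v j)) (allFin M)))

  In𝔄 : (k : ℕ) (L : Subset M → ℕ) {G : ℕ} (A : Fin G → ℚ) (α : Fin G → πM → ℚ) →
        MultiFamily → Set
  In𝔄 k L A α 𝓕 = IsSperner k L 𝓕 × SatisfiesMF A α 𝓕

  Inμ𝔄 : (k : ℕ) (L : Subset M → ℕ) {G : ℕ} (A : Fin G → ℚ) (α : Fin G → πM → ℚ) →
         Matrix → Set
  Inμ𝔄 k L A α q = Σ MultiFamily λ 𝓕 → In𝔄 k L A α 𝓕 × ((v : πM) → q v ≡ profileMatrix 𝓕 v)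

  -- convex hull (finite convex combinations, rational coefficients)
  InConvHull : (Matrix → Set) → Matrix → Set
  InConvHull S p =
    Σ (List (ℚ × Matrix)) λ cs →
      All (λ c → 0ℚ ℚ.≤ proj₁ c × S (proj₂ c)) cs ×
      sumℚ (map proj₁ cs) ≡ 1ℚ ×
      ((v : πM) → p v ≡ sumℚ (map (λ c → proj₁ c ℚ.* proj₂ c v) cs))

  IsExtremePoint : (Matrix → Set) → Matrix → Set
  IsExtremePoint S p =
    InConvHull S p ×
    ((a b : Matrix) (t : ℚ) → InConvHull S a → InConvHull S b →
      0ℚ ℚ.< t → t ℚ.< 1ℚ →
      ((v : πM) → p v ≡ t ℚ.* a v ℚ.+ (1ℚ ℚ.- t) ℚ.* b v) →
      (v : πM) → a v ≡ b v)

module Submission where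

-- The multi-family in which every set F occurs #[profile F, I] times has profile matrix S(I), and it
-- is Sperner because the sets matching a Sperner pattern (P, chains, D) are determined by their
-- profiles, which agree outside P; so S(I) lies in μ(𝔄).
--
-- For extremality, let 𝓕 ∈ 𝔄 and suppose the profile counts of 𝓕 agree with S(I) before position j
-- of the LEM ordering. Since no set of profile u can occur more than #[u, I] times, each set of such
-- a profile u occurs exactly #[u, I] times. Choose F₀ of profile j with the largest multiplicity and,
-- in each block, a maximal chain through F₀. Reading 𝓕 along the products of these chains turns its
-- Sperner property into the transversal property of the multiset I⋆ that equals I before j, equals
-- #[F₀, 𝓕] at j and vanishes elsewhere; I⋆ also satisfies 𝓜_Γ. By LEM, #[F₀, 𝓕] ≤ #[j, I], so the
-- profile count of 𝓕 at j is at most S(I)ⱼ. Hence in a convex combination of profile matrices equal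
-- to S(I), the members of positive weight agree with S(I) position by position, and S(I) is extreme.

open import Defs
open import Data.Nat using (ℕ; _≤_; _<_)
open import Data.Rational using (ℚ; 0ℚ; 1ℚ; mkℚ; *≤*) renaming (_≤_ to _≤ℚ_; _<_ to _<ℚ_)
open import Data.Fin using (Fin; zero; suc; toℕ)
open import Data.Fin.Subset using (Subset; inside; outside; ⊥; _∩_; _∪_; ∁; ∣_∣; _⊆_)
  renaming (_∈_ to _∈ˢ_; _∉_ to _∉ˢ_)

import Algebra.Properties.CommutativeSemigroup as CommutativeSemigroup
open import Data.Bool using (Bool; true; false; T; if_then_else_)
import Data.Bool as Bool
open import Data.Bool.ListAction using (all; any; and)
open import Data.Bool.Properties using (T-≡)
open import Data.Empty using (⊥-elim)
import Data.Fin as Fin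
import Data.Fin.Properties as Fin
open import Data.Fin.Subset.Properties
  using ( ⊆-min; ⊆-antisym; s⊆s; drop-∷-⊆; p⊆q⇒∣p∣≤∣q∣; ∣⊥∣≡0; ∣p∩q∣≤∣q∣; p∩q⊆p; p∩q⊆q
        ; x∈p∩q⁺; x∈p∩q⁻; x∈p∪q⁺; x∈p∪q⁻; x∈p⇒x∉∁p; ∪-identityʳ)
import Data.Integer as ℤ
import Data.Integer.Properties as ℤ
open import Data.List
  using (List; []; _∷_; map; _++_; concatMap; replicate; filterᵇ; length; allFin; applyUpTo
        ; cartesianProductWith; cartesianProduct)
open import Data.List.Properties using (map-++; map-cong; ++-assoc; ++-identityʳ)
open import Data.List.Membership.Propositional using (_∈_; _∉_)
import Data.List.Membership.Propositional.Properties as ∈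
import Data.List.Membership.DecPropositional as DecMembership
open import Data.List.Relation.Unary.All using (All; []; _∷_)
import Data.List.Relation.Unary.All as All
import Data.List.Relation.Unary.All.Properties as AllP
open import Data.List.Relation.Unary.AllPairs using (AllPairs; []; _∷_)
import Data.List.Relation.Unary.AllPairs.Properties as AllPairs
import Data.List.Relation.Unary.Any as Any
open Any using (here; there)
import Data.List.Relation.Unary.Any.Properties as AnyP
open import Data.List.Relation.Unary.Unique.Propositional using (Unique)
import Data.List.Relation.Unary.Unique.Propositional.Properties as Unique
open import Data.Nat as ℕ using (zero; suc; _+_; _*_; _∸_; _⊓_; _≡ᵇ_; z≤n; s≤s)
open import Data.Nat.Combinatorics using (_C_; nCk+nC[k+1]≡[n+1]C[k+1])
import Data.Nat.Coprimality as Coprime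
open import Data.Nat.ListAction.Properties using (sum-++)
import Data.Nat.Properties as ℕ
open import Data.Product using (∃; _×_; _,_; proj₁; proj₂)
import Data.Product.Properties as Product
import Data.Rational as ℚ
import Data.Rational.Properties as ℚ
open import Data.Rational.Solver renaming (module +-*-Solver to ℚ-Solver)
open import Data.Sum using (_⊎_; inj₁; inj₂; [_,_]′)
import Data.Sum as Sum
open import Data.Unit using (tt)
open import Data.Vec using ([]; _∷_; here; there; lookup; tabulate)
import Data.Vec.Properties as Vec
open import Function using (_∘_; _∘′_)
open import Function.Bundles using (Equivalence)
open import Relation.Binary.Definitions using (DecidableEquality; tri<; tri≈; tri>)
open import Relation.Binary.PropositionalEquality
  using (_≡_; _≢_; refl; sym; trans; cong; cong₂; subst; subst₂; module ≡-Reasoning)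
open import Relation.Nullary using (yes; no)
open import Relation.Nullary.Decidable using (⌊_⌋; toWitness; fromWitness)

private
  variable
    A B : Set

-- Finite sums and products of natural numbers over lists

if-T : ∀ {b} {x y : A} → T b → (if b then x else y) ≡ x
if-T {b = true} _ = refl

positive-if : ∀ b {x} → 0 < (if b then x else 0) → T b
positive-if true _ = tt

*-indicator : ∀ b K → K * (if b then 1 else 0) ≡ (if b then K else 0)
*-indicator true  K = ℕ.*-identityʳ K
*-indicator false K = ℕ.*-zeroʳ K

∑ : List A → (A → ℕ) → ℕ
∑ xs f = sumℕ (map f xs)

syntax ∑ xs (λ x → e) = ∑[ x ← xs ] e

∑-cong : (xs : List A) {f g : A → ℕ} → (∀ {x} → x ∈ xs → f x ≡ g x) → ∑ xs f ≡ ∑ xs g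
∑-cong []       f≗g = refl
∑-cong (x ∷ xs) f≗g = cong₂ _+_ (f≗g (here refl)) (∑-cong xs (f≗g ∘′ there))

∑-zero : (xs : List A) → ∑[ x ← xs ] 0 ≡ 0
∑-zero []       = refl
∑-zero (x ∷ xs) = ∑-zero xs

∑-+ : (xs : List A) (f g : A → ℕ) → ∑[ x ← xs ] (f x + g x) ≡ ∑ xs f + ∑ xs g
∑-+ []       f g = refl
∑-+ (x ∷ xs) f g = trans (cong (f x + g x +_) (∑-+ xs f g)) (interchange (f x) (g x) _ _)
  where open CommutativeSemigroup ℕ.+-commutativeSemigroup using (interchange)

∑-*ˡ : (xs : List A) (c : ℕ) (f : A → ℕ) → ∑[ x ← xs ] (c * f x) ≡ c * ∑ xs f
∑-*ˡ []       c f = sym (ℕ.*-zeroʳ c)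
∑-*ˡ (x ∷ xs) c f = trans (cong (c * f x +_) (∑-*ˡ xs c f)) (sym (ℕ.*-distribˡ-+ c (f x) _))

∑-++ : (xs ys : List A) (f : A → ℕ) → ∑ (xs ++ ys) f ≡ ∑ xs f + ∑ ys f
∑-++ xs ys f = trans (cong sumℕ (map-++ f xs ys)) (sum-++ (map f xs) (map f ys))

∑-concatMap : (g : A → List B) (xs : List A) (f : B → ℕ) → ∑ (concatMap g xs) f ≡ ∑[ x ← xs ] ∑ (g x) f
∑-concatMap g []       f = refl
∑-concatMap g (x ∷ xs) f = trans (∑-++ (g x) (concatMap g xs) f) (cong (∑ (g x) f +_) (∑-concatMap g xs f))

∑-replicate : (n : ℕ) (x : A) (f : A → ℕ) → ∑ (replicate n x) f ≡ n * f x
∑-replicate zero    x f = refl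
∑-replicate (suc n) x f = cong (f x +_) (∑-replicate n x f)

length-filterᵇ : (p : A → Bool) (xs : List A) → length (filterᵇ p xs) ≡ ∑[ x ← xs ] (if p x then 1 else 0)
length-filterᵇ p []       = refl
length-filterᵇ p (x ∷ xs) with p x
... | true  = cong suc (length-filterᵇ p xs)
... | false = length-filterᵇ p xs

∑-mono : (xs : List A) {f g : A → ℕ} → (∀ {x} → x ∈ xs → f x ≤ g x) → ∑ xs f ≤ ∑ xs g
∑-mono []       f≤g = z≤n
∑-mono (x ∷ xs) f≤g = ℕ.+-mono-≤ (f≤g (here refl)) (∑-mono xs (f≤g ∘′ there))

∑-mono-< : (xs : List A) {f g : A → ℕ} → (∀ {x} → x ∈ xs → f x ≤ g x) →
           ∀ {x} → x ∈ xs → f x < g x → ∑ xs f < ∑ xs g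
∑-mono-< (y ∷ xs) f≤g (here refl) fy<gy = ℕ.+-mono-<-≤ fy<gy (∑-mono xs (f≤g ∘′ there))
∑-mono-< (y ∷ xs) f≤g (there x∈)  fx<gx =
  ℕ.+-mono-≤-< (f≤g (here refl)) (∑-mono-< xs (f≤g ∘′ there) x∈ fx<gx)

∑-≤-≡ : (xs : List A) {f g : A → ℕ} → (∀ {x} → x ∈ xs → f x ≤ g x) → ∑ xs f ≡ ∑ xs g →
        ∀ {x} → x ∈ xs → f x ≡ g x
∑-≤-≡ xs {f} {g} f≤g sums≡ {x} x∈ with ℕ.<-cmp (f x) (g x)
... | tri< fx<gx _ _ = ⊥-elim (ℕ.<-irrefl sums≡ (∑-mono-< xs f≤g x∈ fx<gx))
... | tri≈ _ fx≡gx _ = fx≡gx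
... | tri> _ _ gx<fx = ⊥-elim (ℕ.<-irrefl refl (ℕ.<-≤-trans gx<fx (f≤g x∈)))

module _ (_≟_ : DecidableEquality A) where

  ∑-indicator : (xs : List A) → Unique xs → ∀ {y} → y ∈ xs → (f : A → ℕ) →
                ∑[ x ← xs ] (if ⌊ x ≟ y ⌋ then f x else 0) ≡ f y
  ∑-indicator (x ∷ xs) (x∉xs ∷ _) (here refl) f with x ≟ x
  ... | no  x≢x = ⊥-elim (x≢x refl)
  ... | yes _   = trans (cong (f x +_) (trans (∑-cong xs off) (∑-zero xs))) (ℕ.+-identityʳ (f x))
    where
    off : ∀ {z} → z ∈ xs → (if ⌊ z ≟ x ⌋ then f z else 0) ≡ 0
    off {z} z∈ with z ≟ x
    ... | yes refl = ⊥-elim (All.lookup x∉xs z∈ refl)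
    ... | no  _    = refl
  ∑-indicator (x ∷ xs) (x∉xs ∷ u) {y} (there y∈) f with x ≟ y
  ... | yes refl = ⊥-elim (All.lookup x∉xs y∈ refl)
  ... | no  _    = ∑-indicator xs u y∈ f

  ∑-split-at : (xs : List A) → Unique xs → ∀ {y} → y ∈ xs → (f : A → ℕ) →
               ∑ xs f ≡ f y + ∑[ x ← xs ] (if ⌊ x ≟ y ⌋ then 0 else f x)
  ∑-split-at xs u {y} y∈ f = begin
    ∑ xs f                         ≡⟨ ∑-cong xs (λ {x} _ → split x) ⟩
    ∑[ x ← xs ] (at-y x + off-y x) ≡⟨ ∑-+ xs at-y off-y ⟩
    ∑ xs at-y + ∑ xs off-y         ≡⟨ cong (_+ ∑ xs off-y) (∑-indicator xs u y∈ f) ⟩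
    f y + ∑ xs off-y               ∎
    where
    open ≡-Reasoning
    at-y off-y : A → ℕ
    at-y  x = if ⌊ x ≟ y ⌋ then f x else 0
    off-y x = if ⌊ x ≟ y ⌋ then 0 else f x
    split : ∀ x → f x ≡ at-y x + off-y x
    split x with ⌊ x ≟ y ⌋
    ... | true  = sym (ℕ.+-identityʳ (f x))
    ... | false = refl

module _ (_≟_ : DecidableEquality B) where

  -- Each x with f x > 0 uses up the term of ys at g x, and distinct such x use distinct terms.
  ∑-≤-reindex : (g : A → B) {xs : List A} {ys : List B} {f : A → ℕ} {h : B → ℕ} →
                Unique xs → Unique ys → (∀ y → y ∈ ys) →
                (∀ {x} → x ∈ xs → f x ≤ h (g x)) →
                (∀ {x x′} → x ∈ xs → x′ ∈ xs → 0 < f x → 0 < f x′ → g x ≡ g x′ → x ≡ x′) →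
                ∑ xs f ≤ ∑ ys h
  ∑-≤-reindex g {[]}     _ _ _ _ _ = z≤n
  ∑-≤-reindex g {x ∷ xs} {ys} {f} {h} (x∉xs ∷ uxs) uys ∈ys f≤hg inj with f x in fx
  ... | zero  = ∑-≤-reindex g uxs uys ∈ys (f≤hg ∘′ there) (λ x∈ x′∈ → inj (there x∈) (there x′∈))
  ... | suc n = begin
    suc n + ∑ xs f                   ≤⟨ ℕ.+-mono-≤ (subst (_≤ h (g x)) fx (f≤hg (here refl))) rest ⟩
    h (g x) + ∑ ys (h-without (g x)) ≡⟨ ∑-split-at _≟_ ys uys (∈ys (g x)) h ⟨
    ∑ ys h                           ∎
    where
    open ℕ.≤-Reasoning
    h-without : B → B → ℕ
    h-without c y = if ⌊ y ≟ c ⌋ then 0 else h y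
    positive : ∀ {x′ k} → f x′ ≡ suc k → 0 < f x′
    positive fx′ = subst (0 <_) (sym fx′) (s≤s z≤n)
    bound : ∀ {x′} → x′ ∈ xs → f x′ ≤ h-without (g x) (g x′)
    bound {x′} x′∈ with g x′ ≟ g x | f x′ in fx′
    ... | no  _      | _      = subst (_≤ h (g x′)) fx′ (f≤hg (there x′∈))
    ... | yes _      | zero   = z≤n
    ... | yes gx′≡gx | suc _  =
      ⊥-elim (All.lookup x∉xs x′∈ (inj (here refl) (there x′∈) (positive fx) (positive fx′) (sym gx′≡gx)))
    rest : ∑ xs f ≤ ∑ ys (h-without (g x))
    rest = ∑-≤-reindex g uxs uys ∈ys bound (λ x∈ x′∈ → inj (there x∈) (there x′∈))

∏ : List A → (A → ℕ) → ℕ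
∏ xs f = prodℕ (map f xs)

syntax ∏ xs (λ x → e) = ∏[ x ← xs ] e

∏-cong : (xs : List A) {f g : A → ℕ} → (∀ {x} → x ∈ xs → f x ≡ g x) → ∏ xs f ≡ ∏ xs g
∏-cong []       f≗g = refl
∏-cong (x ∷ xs) f≗g = cong₂ _*_ (f≗g (here refl)) (∏-cong xs (f≗g ∘′ there))

∏-linear-at : (xs : List A) → Unique xs → ∀ {y} → y ∈ xs → (f g h : A → ℕ) → f y ≡ g y + h y →
              (∀ {x} → x ∈ xs → x ≢ y → f x ≡ g x × f x ≡ h x) → ∏ xs f ≡ ∏ xs g + ∏ xs h
∏-linear-at (x ∷ xs) (x∉xs ∷ _) (here refl) f g h fx≡gx+hx off = begin
  f x * ∏ xs f                ≡⟨ cong (_* ∏ xs f) fx≡gx+hx ⟩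
  (g x + h x) * ∏ xs f        ≡⟨ ℕ.*-distribʳ-+ (∏ xs f) (g x) (h x) ⟩
  g x * ∏ xs f + h x * ∏ xs f ≡⟨ cong₂ (λ a b → g x * a + h x * b) (∏-cong xs (proj₁ ∘ off′))
                                                                     (∏-cong xs (proj₂ ∘ off′)) ⟩
  g x * ∏ xs g + h x * ∏ xs h ∎
  where
  open ≡-Reasoning
  off′ : ∀ {z} → z ∈ xs → f z ≡ g z × f z ≡ h z
  off′ z∈ = off (there z∈) (λ { refl → All.lookup x∉xs z∈ refl })
∏-linear-at (x ∷ xs) (x∉xs ∷ u) {y} (there y∈) f g h fy≡gy+hy off = begin
  f x * ∏ xs f                ≡⟨ cong (f x *_) (∏-linear-at xs u y∈ f g h fy≡gy+hy (off ∘′ there)) ⟩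
  f x * (∏ xs g + ∏ xs h)     ≡⟨ ℕ.*-distribˡ-+ (f x) (∏ xs g) (∏ xs h) ⟩
  f x * ∏ xs g + f x * ∏ xs h ≡⟨ cong₂ (λ a b → a * ∏ xs g + b * ∏ xs h) (proj₁ off-x) (proj₂ off-x) ⟩
  g x * ∏ xs g + h x * ∏ xs h ∎
  where
  open ≡-Reasoning
  off-x : f x ≡ g x × f x ≡ h x
  off-x = off (here refl) (λ { refl → All.lookup x∉xs y∈ refl })

maxℕ-≥ : (f : A → ℕ) {xs : List A} {x : A} → x ∈ xs → f x ≤ maxℕ (map f xs)
maxℕ-≥ f {y ∷ _} (here refl) = ℕ.m≤m⊔n (f y) _
maxℕ-≥ f {y ∷ _} (there x∈)  = ℕ.m≤n⇒m≤o⊔n (f y) (maxℕ-≥ f x∈)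

maxℕ-≤ : (f : A → ℕ) {xs : List A} {c : ℕ} → (∀ {x} → x ∈ xs → f x ≤ c) → maxℕ (map f xs) ≤ c
maxℕ-≤ f {[]}    _   = z≤n
maxℕ-≤ f {_ ∷ _} f≤c = ℕ.⊔-lub (f≤c (here refl)) (maxℕ-≤ f (f≤c ∘′ there))

maxℕ-attained : (f : A → ℕ) (xs : List A) →
                maxℕ (map f xs) ≡ 0 ⊎ ∃ λ x → x ∈ xs × maxℕ (map f xs) ≡ f x
maxℕ-attained f xs with ∈.foldr-selective ℕ.⊔-sel 0 (map f xs)
... | inj₁ max≡0 = inj₁ max≡0
... | inj₂ max∈  with ∈.∈-map⁻ f max∈
...   | x , x∈ , max≡fx = inj₂ (x , x∈ , max≡fx)

s⊓a+[s∸a]⊓b≡s : ∀ {s} a b → s ≤ a + b → s ⊓ a + (s ∸ a) ⊓ b ≡ s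
s⊓a+[s∸a]⊓b≡s {s} a b s≤a+b with ℕ.≤-total s a
... | inj₁ s≤a rewrite ℕ.m≤n⇒m⊓n≡m s≤a | ℕ.m≤n⇒m∸n≡0 s≤a = ℕ.+-identityʳ s
... | inj₂ a≤s rewrite ℕ.m≥n⇒m⊓n≡n a≤s | ℕ.m≤n⇒m⊓n≡m (ℕ.m≤n+o⇒m∸n≤o s a s≤a+b) = ℕ.m+[n∸m]≡n a≤s

Unique-middle : ∀ pre {x : A} post → Unique (pre ++ x ∷ post) → x ∉ pre
Unique-middle (y ∷ pre) post (y∉ ∷ _) (here refl) = All.lookup y∉ (∈.∈-++⁺ʳ pre (here refl)) refl
Unique-middle (y ∷ pre) post (_ ∷ u)  (there x∈)  = Unique-middle pre post u x∈

AllPairs-lookup : ∀ {R : A → A → Set} → (∀ {x} → R x x) → (∀ {x y} → R x y → R y x) →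
                  ∀ {xs} → AllPairs R xs → ∀ {x y} → x ∈ xs → y ∈ xs → R x y
AllPairs-lookup refl′ sym′ (_   ∷ _)   (here refl) (here refl) = refl′
AllPairs-lookup refl′ sym′ (Rx∷ ∷ _)   (here refl) (there y∈)  = All.lookup Rx∷ y∈
AllPairs-lookup refl′ sym′ (Rx∷ ∷ _)   (there x∈)  (here refl) = sym′ (All.lookup Rx∷ x∈)
AllPairs-lookup refl′ sym′ (_   ∷ Rxs) (there x∈)  (there y∈)  = AllPairs-lookup refl′ sym′ Rxs x∈ y∈

concatMap-map≡cartesianProductWith : ∀ {C : Set} (f : A → B → C) (xs : List A) (ys : List B) →
  concatMap (λ x → map (f x) ys) xs ≡ cartesianProductWith f xs ys
concatMap-map≡cartesianProductWith f []       ys = refl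
concatMap-map≡cartesianProductWith f (x ∷ xs) ys =
  cong (map (f x) ys ++_) (concatMap-map≡cartesianProductWith f xs ys)

allSubsets-suc : ∀ n → allSubsets (suc n) ≡ cartesianProductWith (λ X b → b ∷ X) (allSubsets n) (true ∷ false ∷ [])
allSubsets-suc n = concatMap-map≡cartesianProductWith (λ X b → b ∷ X) (allSubsets n) (true ∷ false ∷ [])

∈-allSubsets : ∀ {n} (X : Subset n) → X ∈ allSubsets n
∈-allSubsets []      = here refl
∈-allSubsets (b ∷ X) = subst (b ∷ X ∈_) (sym (allSubsets-suc _))
  (∈.∈-cartesianProductWith⁺ (λ Y c → c ∷ Y) (∈-allSubsets X) (b∈ b))
  where
  b∈ : ∀ b → b ∈ true ∷ false ∷ []
  b∈ true  = here refl
  b∈ false = there (here refl)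

allSubsets-unique : ∀ n → Unique (allSubsets n)
allSubsets-unique zero    = [] ∷ []
allSubsets-unique (suc n) = subst Unique (sym (allSubsets-suc n))
  (Unique.cartesianProductWith⁺ (λ Y c → c ∷ Y) ∷-injective (allSubsets-unique n) (((λ ()) ∷ []) ∷ [] ∷ []))
  where
  ∷-injective : ∀ {n} {b c} {X Y : Subset n} → b ∷ X ≡ c ∷ Y → X ≡ Y × b ≡ c
  ∷-injective refl = refl , refl

∑-allSubsets-suc : ∀ n (f : Subset (suc n) → ℕ) →
  ∑ (allSubsets (suc n)) f ≡ ∑[ X ← allSubsets n ] f (inside ∷ X) + ∑[ X ← allSubsets n ] f (outside ∷ X)
∑-allSubsets-suc n f = begin
  ∑ (allSubsets (suc n)) f
    ≡⟨ ∑-concatMap _ (allSubsets n) f ⟩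
  ∑[ X ← allSubsets n ] (f (inside ∷ X) + (f (outside ∷ X) + 0))
    ≡⟨ ∑-cong (allSubsets n) (λ {X} _ → cong (f (inside ∷ X) +_) (ℕ.+-identityʳ _)) ⟩
  ∑[ X ← allSubsets n ] (f (inside ∷ X) + f (outside ∷ X))
    ≡⟨ ∑-+ (allSubsets n) _ _ ⟩
  ∑[ X ← allSubsets n ] f (inside ∷ X) + ∑[ X ← allSubsets n ] f (outside ∷ X) ∎
  where open ≡-Reasoning

allPi-suc : ∀ M (n : Fin (suc M) → ℕ) → allPi (suc M) n ≡ cartesianProduct (allFin (n zero)) (allPi M (n ∘ suc))
allPi-suc M n = concatMap-map≡cartesianProductWith _,_ (allFin (n zero)) (allPi M (n ∘ suc))

∈-allPi : ∀ M (n : Fin M → ℕ) (v : Pi M n) → v ∈ allPi M n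
∈-allPi zero    n tt      = here refl
∈-allPi (suc M) n (a , v) = subst ((a , v) ∈_) (sym (allPi-suc M n))
  (∈.∈-cartesianProduct⁺ (∈.∈-allFin a) (∈-allPi M (n ∘ suc) v))

allPi-unique : ∀ M (n : Fin M → ℕ) → Unique (allPi M n)
allPi-unique zero    n = [] ∷ []
allPi-unique (suc M) n = subst Unique (sym (allPi-suc M n))
  (Unique.cartesianProduct⁺ (Unique.allFin⁺ (n zero)) (allPi-unique M (n ∘ suc)))

Pi-≟ : ∀ M (n : Fin M → ℕ) → DecidableEquality (Pi M n)
Pi-≟ zero    n tt tt = yes refl
Pi-≟ (suc M) n = Product.≡-dec Fin._≟_ (Pi-≟ M (n ∘ suc))

tabulatePi : ∀ M (n : Fin M → ℕ) → ((i : Fin M) → Fin (n i)) → Pi M n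
tabulatePi zero    n f = tt
tabulatePi (suc M) n f = f zero , tabulatePi M (n ∘ suc) (f ∘ suc)

coord-tabulatePi : ∀ M (n : Fin M → ℕ) (f : (i : Fin M) → Fin (n i)) i → coord (tabulatePi M n f) i ≡ f i
coord-tabulatePi (suc M) n f zero    = refl
coord-tabulatePi (suc M) n f (suc i) = coord-tabulatePi M (n ∘ suc) (f ∘ suc) i

coord-injective : ∀ M (n : Fin M → ℕ) {v w : Pi M n} → (∀ i → coord v i ≡ coord w i) → v ≡ w
coord-injective zero    n {tt}    {tt}    _   = refl
coord-injective (suc M) n {a , v} {b , w} v≐w = cong₂ _,_ (v≐w zero) (coord-injective M (n ∘ suc) (v≐w ∘ suc))

_≟ˢ_ : ∀ {n} → DecidableEquality (Subset n)
_≟ˢ_ = Vec.≡-dec Bool._≟_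

∈-tabulate⁻ : ∀ {n} {f : Fin n → Bool} {x} → x ∈ˢ tabulate f → T (f x)
∈-tabulate⁻ {f = f} {x} x∈ = Equivalence.from T-≡ (trans (sym (Vec.lookup∘tabulate f x)) (Vec.[]=⇒lookup x∈))

∈-tabulate⁺ : ∀ {n} {f : Fin n → Bool} {x} → T (f x) → x ∈ˢ tabulate f
∈-tabulate⁺ {f = f} {x} fx = Vec.lookup⇒[]= x _ (trans (Vec.lookup∘tabulate f x) (Equivalence.to T-≡ fx))

∪-⊆ : ∀ {n} {p q r : Subset n} → p ⊆ r → q ⊆ r → p ∪ q ⊆ r
∪-⊆ p⊆r q⊆r x∈ = [ p⊆r , q⊆r ]′ (x∈p∪q⁻ _ _ x∈)

∪-mono-⊆ : ∀ {n} {p p′ q q′ : Subset n} → p ⊆ p′ → q ⊆ q′ → p ∪ q ⊆ p′ ∪ q′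
∪-mono-⊆ p⊆p′ q⊆q′ x∈ = x∈p∪q⁺ (Sum.map p⊆p′ q⊆q′ (x∈p∪q⁻ _ _ x∈))

∣p∪q∣≡∣p∣+∣q∣ : ∀ {n} (p q : Subset n) → (∀ {x} → x ∈ˢ p → x ∉ˢ q) → ∣ p ∪ q ∣ ≡ ∣ p ∣ + ∣ q ∣
∣p∪q∣≡∣p∣+∣q∣ []            []            _    = refl
∣p∪q∣≡∣p∣+∣q∣ (inside ∷ p)  (inside ∷ q)  disj = ⊥-elim (disj here here)
∣p∪q∣≡∣p∣+∣q∣ (inside ∷ p)  (outside ∷ q) disj = cong suc (∣p∪q∣≡∣p∣+∣q∣ p q (λ x∈p → disj (there x∈p) ∘ there))
∣p∪q∣≡∣p∣+∣q∣ (outside ∷ p) (inside ∷ q)  disj =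
  trans (cong suc (∣p∪q∣≡∣p∣+∣q∣ p q (λ x∈p → disj (there x∈p) ∘ there))) (sym (ℕ.+-suc ∣ p ∣ ∣ q ∣))
∣p∪q∣≡∣p∣+∣q∣ (outside ∷ p) (outside ∷ q) disj = ∣p∪q∣≡∣p∣+∣q∣ p q (λ x∈p → disj (there x∈p) ∘ there)

∣p∩q∣+∣∁p∩q∣≡∣q∣ : ∀ {n} (p q : Subset n) → ∣ p ∩ q ∣ + ∣ ∁ p ∩ q ∣ ≡ ∣ q ∣
∣p∩q∣+∣∁p∩q∣≡∣q∣ []            []            = refl
∣p∩q∣+∣∁p∩q∣≡∣q∣ (inside ∷ p)  (inside ∷ q)  = cong suc (∣p∩q∣+∣∁p∩q∣≡∣q∣ p q)
∣p∩q∣+∣∁p∩q∣≡∣q∣ (outside ∷ p) (inside ∷ q)  = trans (ℕ.+-suc _ _) (cong suc (∣p∩q∣+∣∁p∩q∣≡∣q∣ p q))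
∣p∩q∣+∣∁p∩q∣≡∣q∣ (inside ∷ p)  (outside ∷ q) = ∣p∩q∣+∣∁p∩q∣≡∣q∣ p q
∣p∩q∣+∣∁p∩q∣≡∣q∣ (outside ∷ p) (outside ∷ q) = ∣p∩q∣+∣∁p∩q∣≡∣q∣ p q

p⊆q∧∣p∣≡∣q∣⇒p≡q : ∀ {n} {p q : Subset n} → p ⊆ q → ∣ p ∣ ≡ ∣ q ∣ → p ≡ q
p⊆q∧∣p∣≡∣q∣⇒p≡q {p = []}          {[]}          _   _   = refl
p⊆q∧∣p∣≡∣q∣⇒p≡q {p = inside ∷ p}  {inside ∷ q}  p⊆q ∣≡∣ =
  cong (inside ∷_) (p⊆q∧∣p∣≡∣q∣⇒p≡q (drop-∷-⊆ p⊆q) (ℕ.suc-injective ∣≡∣))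
p⊆q∧∣p∣≡∣q∣⇒p≡q {p = inside ∷ p}  {outside ∷ q} p⊆q _   with p⊆q here
... | ()
p⊆q∧∣p∣≡∣q∣⇒p≡q {p = outside ∷ p} {inside ∷ q}  p⊆q ∣≡∣ =
  ⊥-elim (ℕ.n≮n ∣ q ∣ (subst (_≤ ∣ q ∣) ∣≡∣ (p⊆q⇒∣p∣≤∣q∣ (drop-∷-⊆ p⊆q))))
p⊆q∧∣p∣≡∣q∣⇒p≡q {p = outside ∷ p} {outside ∷ q} p⊆q ∣≡∣ =
  cong (outside ∷_) (p⊆q∧∣p∣≡∣q∣⇒p≡q (drop-∷-⊆ p⊆q) ∣≡∣)

comparable∧∣≡∣⇒≡ : ∀ {n} {p q : Subset n} → p ⊆ q ⊎ q ⊆ p → ∣ p ∣ ≡ ∣ q ∣ → p ≡ q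
comparable∧∣≡∣⇒≡ (inj₁ p⊆q) ∣≡∣ = p⊆q∧∣p∣≡∣q∣⇒p≡q p⊆q ∣≡∣
comparable∧∣≡∣⇒≡ (inj₂ q⊆p) ∣≡∣ = sym (p⊆q∧∣p∣≡∣q∣⇒p≡q q⊆p (sym ∣≡∣))

initialSegment : ∀ {n} → ℕ → Subset n → Subset n
initialSegment zero    _             = ⊥
initialSegment (suc s) []            = []
initialSegment (suc s) (outside ∷ X) = outside ∷ initialSegment (suc s) X
initialSegment (suc s) (inside ∷ X)  = inside ∷ initialSegment s X

initialSegment-⊆ : ∀ {n} s (X : Subset n) → initialSegment s X ⊆ X
initialSegment-⊆ zero    X             = ⊆-min X
initialSegment-⊆ (suc s) []            = λ ()
initialSegment-⊆ (suc s) (outside ∷ X) = s⊆s (initialSegment-⊆ (suc s) X)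
initialSegment-⊆ (suc s) (inside ∷ X)  = s⊆s (initialSegment-⊆ s X)

initialSegment-mono : ∀ {n} {s s′} (X : Subset n) → s ≤ s′ → initialSegment s X ⊆ initialSegment s′ X
initialSegment-mono X             z≤n        = ⊆-min _
initialSegment-mono []            (s≤s _)    = λ ()
initialSegment-mono (outside ∷ X) (s≤s s≤s′) = s⊆s (initialSegment-mono X (s≤s s≤s′))
initialSegment-mono (inside ∷ X)  (s≤s s≤s′) = s⊆s (initialSegment-mono X s≤s′)

∣initialSegment∣ : ∀ {n} s (X : Subset n) → ∣ initialSegment s X ∣ ≡ s ⊓ ∣ X ∣
∣initialSegment∣ {n} zero _            = ∣⊥∣≡0 n
∣initialSegment∣ (suc s) []            = refl
∣initialSegment∣ (suc s) (outside ∷ X) = ∣initialSegment∣ (suc s) X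
∣initialSegment∣ (suc s) (inside ∷ X)  = cong suc (∣initialSegment∣ s X)

initialSegment-all : ∀ {n} s (X : Subset n) → ∣ X ∣ ≤ s → initialSegment s X ≡ X
initialSegment-all s X ∣X∣≤s =
  p⊆q∧∣p∣≡∣q∣⇒p≡q (initialSegment-⊆ s X) (trans (∣initialSegment∣ s X) (ℕ.m≥n⇒m⊓n≡n ∣X∣≤s))

-- Counting the subsets with prescribed block sizes

_[_]≔_ : ∀ {M} → (Fin M → A) → Fin M → A → Fin M → A
(f [ p ]≔ a) i = if ⌊ p Fin.≟ i ⌋ then a else f i

module _ {N M : ℕ} (part : Fin N → Fin M) where

  hasBlockSizes : (Fin M → ℕ) → Subset N → Bool
  hasBlockSizes w G = all (λ i → ∣ G ∩ block part i ∣ ≡ᵇ w i) (allFin M)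

  #withBlockSizes : (Fin M → ℕ) → ℕ
  #withBlockSizes w = ∑[ G ← allSubsets N ] (if hasBlockSizes w G then 1 else 0)

module _ {N M : ℕ} (part : Fin (suc N) → Fin M) where

  private
    p : Fin M
    p = part zero
    part′ : Fin N → Fin M
    part′ = part ∘ suc

    ∣inside∷X∩block-p∣ : ∀ X → ∣ (inside ∷ X) ∩ block part p ∣ ≡ suc ∣ X ∩ block part′ p ∣
    ∣inside∷X∩block-p∣ X with p Fin.≟ p
    ... | yes _   = refl
    ... | no  p≢p = ⊥-elim (p≢p refl)

    msize-p : msize part p ≡ suc (msize part′ p)
    msize-p with p Fin.≟ p
    ... | yes _   = refl
    ... | no  p≢p = ⊥-elim (p≢p refl)

    #inside : (Fin M → ℕ) → ℕ
    #inside w = ∑[ X ← allSubsets N ] (if hasBlockSizes part w (inside ∷ X) then 1 else 0)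

    #withBlockSizes-suc : ∀ w → #withBlockSizes part w ≡ #inside w + #withBlockSizes part′ w
    #withBlockSizes-suc w = ∑-allSubsets-suc N _

  #withBlockSizes-zeroAt : ∀ {w : Fin M → ℕ} → w p ≡ 0 → #withBlockSizes part w ≡ #withBlockSizes part′ w
  #withBlockSizes-zeroAt {w} wp≡0 =
    trans (#withBlockSizes-suc w)
          (cong (_+ #withBlockSizes part′ w) (trans (∑-cong (allSubsets N) none) (∑-zero (allSubsets N))))
    where
    none : ∀ {X} → X ∈ allSubsets N → (if hasBlockSizes part w (inside ∷ X) then 1 else 0) ≡ 0
    none {X} _ with hasBlockSizes part w (inside ∷ X) in sizes
    ... | false = refl
    ... | true  = ⊥-elim (subst₂ (λ a b → T (a ≡ᵇ b)) (∣inside∷X∩block-p∣ X) wp≡0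
                    (All.lookup (AllP.all⁺ _ (allFin M) (Equivalence.from T-≡ sizes)) (∈.∈-allFin p)))

  #withBlockSizes-sucAt : ∀ {w : Fin M → ℕ} {k} → w p ≡ suc k →
                          #withBlockSizes part w ≡ #withBlockSizes part′ (w [ p ]≔ k) + #withBlockSizes part′ w
  #withBlockSizes-sucAt {w} {k} wp≡1+k =
    trans (#withBlockSizes-suc w) (cong (_+ #withBlockSizes part′ w) (∑-cong (allSubsets N) (λ {X} _ → shift X)))
    where
    shift : ∀ X → (if hasBlockSizes part w (inside ∷ X) then 1 else 0) ≡ (if hasBlockSizes part′ (w [ p ]≔ k) X then 1 else 0)
    shift X = cong (λ b → if b then 1 else 0) (cong and (map-cong at (allFin M)))
      where
      at : ∀ i → (∣ (inside ∷ X) ∩ block part i ∣ ≡ᵇ w i) ≡ (∣ X ∩ block part′ i ∣ ≡ᵇ (w [ p ]≔ k) i)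
      at i with p Fin.≟ i
      ... | yes refl rewrite wp≡1+k = refl
      ... | no  _    = refl

  ∏binomial-zeroAt : ∀ {w : Fin M → ℕ} → w p ≡ 0 →
                     ∏[ j ← allFin M ] (msize part′ j C w j) ≡ ∏[ j ← allFin M ] (msize part j C w j)
  ∏binomial-zeroAt {w} wp≡0 = ∏-cong (allFin M) (λ {j} _ → at j)
    where
    at : ∀ j → msize part′ j C w j ≡ msize part j C w j
    at j with p Fin.≟ j
    ... | yes refl rewrite wp≡0 = refl
    ... | no  _    = refl

  ∏binomial-sucAt : ∀ {w : Fin M → ℕ} {k} → w p ≡ suc k →
    ∏[ j ← allFin M ] (msize part j C w j) ≡
    ∏[ j ← allFin M ] (msize part′ j C (w [ p ]≔ k) j) + ∏[ j ← allFin M ] (msize part′ j C w j)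
  ∏binomial-sucAt {w} {k} wp≡1+k = ∏-linear-at (allFin M) (Unique.allFin⁺ M) (∈.∈-allFin p) _ _ _ pascal off-p
    where
    [p]≔k-at-p : (w [ p ]≔ k) p ≡ k
    [p]≔k-at-p with p Fin.≟ p
    ... | yes _   = refl
    ... | no  p≢p = ⊥-elim (p≢p refl)
    pascal : msize part p C w p ≡ msize part′ p C (w [ p ]≔ k) p + msize part′ p C w p
    pascal rewrite [p]≔k-at-p | msize-p | wp≡1+k = sym (nCk+nC[k+1]≡[n+1]C[k+1] (msize part′ p) k)
    off-p : ∀ {j} → j ∈ allFin M → j ≢ p →
            msize part j C w j ≡ msize part′ j C (w [ p ]≔ k) j × msize part j C w j ≡ msize part′ j C w j
    off-p {j} _ j≢p with p Fin.≟ j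
    ... | yes p≡j = ⊥-elim (j≢p (sym p≡j))
    ... | no  _   = refl , refl

#withBlockSizes≡∏binomial : ∀ {N M} (part : Fin N → Fin M) (w : Fin M → ℕ) →
  #withBlockSizes part w ≡ ∏[ j ← allFin M ] (msize part j C w j)
#withBlockSizes≡∏binomial {zero} {M} part w = trans (ℕ.+-identityʳ _) (empty (allFin M))
  where
  empty : ∀ is → (if all (λ i → 0 ≡ᵇ w i) is then 1 else 0) ≡ ∏[ j ← is ] (0 C w j)
  empty []       = refl
  empty (i ∷ is) with w i
  ... | zero  = trans (empty is) (sym (ℕ.+-identityʳ _))
  ... | suc _ = refl
#withBlockSizes≡∏binomial {suc N} part w with w (part zero) in wp
... | zero  = trans (#withBlockSizes-zeroAt part wp)
                    (trans (#withBlockSizes≡∏binomial (part ∘ suc) w) (∏binomial-zeroAt part {w} wp))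
... | suc k = trans (#withBlockSizes-sucAt part wp)
                    (trans (cong₂ _+_ (#withBlockSizes≡∏binomial (part ∘ suc) _)
                                      (#withBlockSizes≡∏binomial (part ∘ suc) w))
                           (sym (∏binomial-sucAt part {w} wp)))

ℕtoℚ≡mkℚ : ∀ n → ℕtoℚ n ≡ mkℚ (ℤ.+ n) 0 (Coprime.sym (Coprime.1-coprimeTo n))
ℕtoℚ≡mkℚ n = ℚ.normalize-coprime (Coprime.sym (Coprime.1-coprimeTo n))

ℕtoℚ-mono-≤ : ∀ {a b} → a ≤ b → ℕtoℚ a ≤ℚ ℕtoℚ b
ℕtoℚ-mono-≤ {a} {b} a≤b rewrite ℕtoℚ≡mkℚ a | ℕtoℚ≡mkℚ b =
  *≤* (subst₂ ℤ._≤_ (sym (ℤ.*-identityʳ (ℤ.+ a))) (sym (ℤ.*-identityʳ (ℤ.+ b))) (ℤ.+≤+ a≤b))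

ℕtoℚ-injective : ∀ {a b} → ℕtoℚ a ≡ ℕtoℚ b → a ≡ b
ℕtoℚ-injective {a} {b} eq rewrite ℕtoℚ≡mkℚ a | ℕtoℚ≡mkℚ b = ℤ.+-injective (cong ℚ.numerator eq)

0<1-t : ∀ {t} → t <ℚ 1ℚ → 0ℚ <ℚ 1ℚ ℚ.- t
0<1-t {t} t<1 = subst (_<ℚ 1ℚ ℚ.- t) (ℚ.+-inverseʳ t) (ℚ.+-monoˡ-< (ℚ.- t) t<1)

pos*pos : ∀ {a b} → 0ℚ <ℚ a → 0ℚ <ℚ b → 0ℚ <ℚ a ℚ.* b
pos*pos {a} {b} 0<a 0<b = ℚ.positive⁻¹ (a ℚ.* b) {{ℚ.pos*pos⇒pos a {{ℚ.positive 0<a}} b {{ℚ.positive 0<b}}}}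

nonNeg*nonNeg : ∀ {a b} → 0ℚ ≤ℚ a → 0ℚ ≤ℚ b → 0ℚ ≤ℚ a ℚ.* b
nonNeg*nonNeg {a} {b} 0≤a 0≤b =
  ℚ.nonNegative⁻¹ (a ℚ.* b) {{ℚ.nonNeg*nonNeg⇒nonNeg a {{ℚ.nonNegative 0≤a}} b {{ℚ.nonNegative 0≤b}}}}

0≤⇒0≡∨0< : ∀ {w} → 0ℚ ≤ℚ w → w ≡ 0ℚ ⊎ 0ℚ <ℚ w
0≤⇒0≡∨0< {w} 0≤w with ℚ.<-cmp 0ℚ w
... | tri< 0<w _ _ = inj₂ 0<w
... | tri≈ _ 0≡w _ = inj₁ (sym 0≡w)
... | tri> _ _ w<0 = ⊥-elim (ℚ.<-irrefl refl (ℚ.<-≤-trans w<0 0≤w))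

∑ℚ : List A → (A → ℚ) → ℚ
∑ℚ xs f = sumℚ (map f xs)

syntax ∑ℚ xs (λ x → e) = ∑ℚ[ x ← xs ] e

∑ℚ-cong : (xs : List A) {f g : A → ℚ} → (∀ {x} → x ∈ xs → f x ≡ g x) → ∑ℚ xs f ≡ ∑ℚ xs g
∑ℚ-cong []       f≗g = refl
∑ℚ-cong (x ∷ xs) f≗g = cong₂ ℚ._+_ (f≗g (here refl)) (∑ℚ-cong xs (f≗g ∘′ there))

∑ℚ-++ : (xs ys : List A) (f : A → ℚ) → ∑ℚ (xs ++ ys) f ≡ ∑ℚ xs f ℚ.+ ∑ℚ ys f
∑ℚ-++ []       ys f = sym (ℚ.+-identityˡ _)
∑ℚ-++ (x ∷ xs) ys f = trans (cong (f x ℚ.+_) (∑ℚ-++ xs ys f)) (sym (ℚ.+-assoc (f x) _ _))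

∑ℚ-map : (g : A → B) (xs : List A) (f : B → ℚ) → ∑ℚ (map g xs) f ≡ ∑ℚ xs (f ∘ g)
∑ℚ-map g []       f = refl
∑ℚ-map g (x ∷ xs) f = cong (f (g x) ℚ.+_) (∑ℚ-map g xs f)

∑ℚ-*ˡ : (xs : List A) (c : ℚ) (f : A → ℚ) → ∑ℚ[ x ← xs ] (c ℚ.* f x) ≡ c ℚ.* ∑ℚ xs f
∑ℚ-*ˡ []       c f = sym (ℚ.*-zeroʳ c)
∑ℚ-*ˡ (x ∷ xs) c f = trans (cong (c ℚ.* f x ℚ.+_) (∑ℚ-*ˡ xs c f)) (sym (ℚ.*-distribˡ-+ c (f x) _))

∑ℚ-*ʳ : (xs : List A) (f : A → ℚ) (c : ℚ) → ∑ℚ[ x ← xs ] (f x ℚ.* c) ≡ ∑ℚ xs f ℚ.* c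
∑ℚ-*ʳ []       f c = sym (ℚ.*-zeroˡ c)
∑ℚ-*ʳ (x ∷ xs) f c = trans (cong (f x ℚ.* c ℚ.+_) (∑ℚ-*ʳ xs f c)) (sym (ℚ.*-distribʳ-+ c (f x) _))

∑ℚ-weighted-constant : (xs : List A) (w : A → ℚ) → ∑ℚ xs w ≡ 1ℚ → ∀ r → ∑ℚ[ x ← xs ] (w x ℚ.* r) ≡ r
∑ℚ-weighted-constant xs w ∑w≡1 r = trans (∑ℚ-*ʳ xs w r) (trans (cong (ℚ._* r) ∑w≡1) (ℚ.*-identityˡ r))

∑ℚ-mono : (xs : List A) {f g : A → ℚ} → (∀ {x} → x ∈ xs → f x ≤ℚ g x) → ∑ℚ xs f ≤ℚ ∑ℚ xs g
∑ℚ-mono []       f≤g = ℚ.≤-refl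
∑ℚ-mono (x ∷ xs) f≤g = ℚ.+-mono-≤ (f≤g (here refl)) (∑ℚ-mono xs (f≤g ∘′ there))

∑ℚ-mono-< : (xs : List A) {f g : A → ℚ} → (∀ {x} → x ∈ xs → f x ≤ℚ g x) →
            ∀ {x} → x ∈ xs → f x <ℚ g x → ∑ℚ xs f <ℚ ∑ℚ xs g
∑ℚ-mono-< (y ∷ xs) f≤g (here refl) fy<gy = ℚ.+-mono-<-≤ fy<gy (∑ℚ-mono xs (f≤g ∘′ there))
∑ℚ-mono-< (y ∷ xs) f≤g (there x∈)  fx<gx =
  ℚ.+-mono-≤-< (f≤g (here refl)) (∑ℚ-mono-< xs (f≤g ∘′ there) x∈ fx<gx)

weighted-∑-≤-≡ : (xs : List A) (w f g : A → ℚ) → (∀ {x} → x ∈ xs → 0ℚ ≤ℚ w x) →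
                 (∀ {x} → x ∈ xs → 0ℚ <ℚ w x → f x ≤ℚ g x) →
                 ∑ℚ[ x ← xs ] (w x ℚ.* f x) ≡ ∑ℚ[ x ← xs ] (w x ℚ.* g x) →
                 ∀ {x} → x ∈ xs → 0ℚ <ℚ w x → f x ≡ g x
weighted-∑-≤-≡ xs w f g w≥0 f≤g sums≡ {x} x∈ 0<wx with ℚ.<-cmp (f x) (g x)
... | tri< fx<gx _ _ =
  ⊥-elim (ℚ.<-irrefl sums≡ (∑ℚ-mono-< xs wf≤wg x∈ (ℚ.*-monoʳ-<-pos (w x) {{ℚ.positive 0<wx}} fx<gx)))
  where
  wf≤wg : ∀ {y} → y ∈ xs → w y ℚ.* f y ≤ℚ w y ℚ.* g y
  wf≤wg {y} y∈ with 0≤⇒0≡∨0< (w≥0 y∈)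
  ... | inj₁ wy≡0 rewrite wy≡0 = ℚ.≤-reflexive (trans (ℚ.*-zeroˡ (f y)) (sym (ℚ.*-zeroˡ (g y))))
  ... | inj₂ 0<wy = ℚ.*-monoˡ-≤-nonNeg (w y) {{ℚ.nonNegative (w≥0 y∈)}} (f≤g y∈ 0<wy)
... | tri≈ _ fx≡gx _ = fx≡gx
... | tri> _ _ gx<fx = ⊥-elim (ℚ.<-irrefl refl (ℚ.<-≤-trans gx<fx (f≤g x∈ 0<wx)))

module _ {N M : ℕ} (part : Fin N → Fin M) where

  private
    X : Fin M → Subset N
    X = block part
    m : Fin M → ℕ
    m = msize part

  ∈-block⁻ : ∀ {x j} → x ∈ˢ X j → part x ≡ j
  ∈-block⁻ x∈ = toWitness (∈-tabulate⁻ x∈)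

  ∈-block⁺ : ∀ x → x ∈ˢ X (part x)
  ∈-block⁺ x = ∈-tabulate⁺ (fromWitness refl)

  ∩-block-injective : ∀ {F G} → (∀ j → F ∩ X j ≡ G ∩ X j) → F ≡ G
  ∩-block-injective F≐G = ⊆-antisym (⊆-by-blocks F≐G) (⊆-by-blocks (sym ∘ F≐G))
    where
    ⊆-by-blocks : ∀ {F G} → (∀ j → F ∩ X j ≡ G ∩ X j) → F ⊆ G
    ⊆-by-blocks {F} {G} F≐G {x} x∈F =
      proj₁ (x∈p∩q⁻ G _ (subst (x ∈ˢ_) (F≐G (part x)) (x∈p∩q⁺ (x∈F , ∈-block⁺ x))))

  glue : (Fin M → Subset N) → Subset N
  glue Y = tabulate (λ x → lookup (Y (part x)) x)

  glue-∩-block : ∀ {Y} → (∀ j → Y j ⊆ X j) → ∀ j → glue Y ∩ X j ≡ Y j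
  glue-∩-block {Y} Y⊆X j = ⊆-antisym ⊆Y ⊇Y
    where
    ⊆Y : glue Y ∩ X j ⊆ Y j
    ⊆Y {x} x∈ with x∈p∩q⁻ (glue Y) (X j) x∈
    ... | x∈glue , x∈Xj =
      subst (λ i → x ∈ˢ Y i) (∈-block⁻ x∈Xj) (Vec.lookup⇒[]= x _ (Equivalence.to T-≡ (∈-tabulate⁻ x∈glue)))
    ⊇Y : Y j ⊆ glue Y ∩ X j
    ⊇Y {x} x∈Y = x∈p∩q⁺ (∈-tabulate⁺ (Equivalence.from T-≡ (Vec.[]=⇒lookup x∈Y′)) , Y⊆X j x∈Y)
      where
      x∈Y′ : x ∈ˢ Y (part x)
      x∈Y′ = subst (λ i → x ∈ˢ Y i) (sym (∈-block⁻ (Y⊆X j x∈Y))) x∈Y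

  _≟π_ : DecidableEquality (πM part)
  _≟π_ = Pi-≟ M (suc ∘ m)

  open DecMembership _≟π_ using (_∈?_)

  ∈-allπM : ∀ v → v ∈ allπM part
  ∈-allπM = ∈-allPi M (suc ∘ m)

  allπM-unique : Unique (allπM part)
  allπM-unique = allPi-unique M (suc ∘ m)

  sizesOf : (Fin M → Subset N) → πM part
  sizesOf Y = tabulatePi M (suc ∘ m) (λ i → Fin.fromℕ< (s≤s (∣p∩q∣≤∣q∣ (Y i) (X i))))

  toℕ-sizesOf : ∀ Y i → toℕ (coord (sizesOf Y) i) ≡ ∣ Y i ∩ X i ∣
  toℕ-sizesOf Y i = trans (cong toℕ (coord-tabulatePi M (suc ∘ m) _ i)) (Fin.toℕ-fromℕ< _)

  profile : Subset N → πM part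
  profile F = sizesOf (λ _ → F)

  ≡-by-sizes : ∀ {v w : πM part} → (∀ i → toℕ (coord v i) ≡ toℕ (coord w i)) → v ≡ w
  ≡-by-sizes v≐w = coord-injective M (suc ∘ m) (Fin.toℕ-injective ∘ v≐w)

  hasProfile⁻ : ∀ F {v} → T (hasProfile part F v) → ∀ i → ∣ F ∩ X i ∣ ≡ toℕ (coord v i)
  hasProfile⁻ F hp i = ℕ.≡ᵇ⇒≡ _ _ (All.lookup (AllP.all⁺ _ (allFin M) hp) (∈.∈-allFin i))

  hasProfile⁺ : ∀ F {v} → (∀ i → ∣ F ∩ X i ∣ ≡ toℕ (coord v i)) → T (hasProfile part F v)
  hasProfile⁺ F sizes = AllP.all⁻ _ (All.universal (λ i → ℕ.≡⇒≡ᵇ _ _ (sizes i)) (allFin M))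

  hasProfile⇒≡ : ∀ F {v} → T (hasProfile part F v) → profile F ≡ v
  hasProfile⇒≡ F hp = ≡-by-sizes (λ i → trans (toℕ-sizesOf (λ _ → F) i) (hasProfile⁻ F hp i))

  profile≡⇒∣∩X∣≡ : ∀ {F G} → profile F ≡ profile G → ∀ j → ∣ F ∩ X j ∣ ≡ ∣ G ∩ X j ∣
  profile≡⇒∣∩X∣≡ {F} {G} same j =
    trans (sym (toℕ-sizesOf (λ _ → F) j)) (trans (cong (λ v → toℕ (coord v j)) same) (toℕ-sizesOf (λ _ → G) j))

  -- S(I) v = #[v, I] · classSize v, where classSize v counts the subsets of X with profile v.
  classSize : πM part → ℕ
  classSize v = ∏[ j ← allFin M ] (m j C toℕ (coord v j))

  ∑-hasProfile : ∀ v K → ∑[ G ← allSubsets N ] (if hasProfile part G v then K else 0) ≡ K * classSize v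
  ∑-hasProfile v K = begin
    ∑[ G ← allSubsets N ] (if hasProfile part G v then K else 0)
      ≡⟨ ∑-cong (allSubsets N) (λ {G} _ → *-indicator (hasProfile part G v) K) ⟨
    ∑[ G ← allSubsets N ] (K * (if hasProfile part G v then 1 else 0))
      ≡⟨ ∑-*ˡ (allSubsets N) K _ ⟩
    K * #withBlockSizes part (toℕ ∘ coord v)
      ≡⟨ cong (K *_) (#withBlockSizes≡∏binomial part (toℕ ∘ coord v)) ⟩
    K * classSize v ∎
    where open ≡-Reasoning

  multF-∷ : ∀ F G 𝓕 → multF part G (F ∷ 𝓕) ≡ (if ⌊ F ≟ˢ G ⌋ then 1 else 0) + multF part G 𝓕
  multF-∷ F G 𝓕 with ⌊ F ≟ˢ G ⌋
  ... | true  = refl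
  ... | false = refl

  length-filterᵇ≡∑multF : ∀ (q : Subset N → Bool) 𝓕 →
    length (filterᵇ q 𝓕) ≡ ∑[ G ← allSubsets N ] (if q G then multF part G 𝓕 else 0)
  length-filterᵇ≡∑multF q [] = sym (trans (∑-cong (allSubsets N) (λ {G} _ → if-0 (q G))) (∑-zero (allSubsets N)))
    where
    if-0 : ∀ b → (if b then 0 else 0) ≡ 0
    if-0 true  = refl
    if-0 false = refl
  length-filterᵇ≡∑multF q (F ∷ 𝓕) = begin
    length (filterᵇ q (F ∷ 𝓕))
      ≡⟨ length-filterᵇ-∷ ⟩
    (if q F then 1 else 0) + length (filterᵇ q 𝓕)
      ≡⟨ cong₂ _+_ (sym (∑-indicator _≟ˢ_ (allSubsets N) (allSubsets-unique N) (∈-allSubsets F) [q]))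
                   (length-filterᵇ≡∑multF q 𝓕) ⟩
    ∑ (allSubsets N) [q]-at-F + ∑[ G ← allSubsets N ] (if q G then multF part G 𝓕 else 0)
      ≡⟨ ∑-+ (allSubsets N) _ _ ⟨
    ∑[ G ← allSubsets N ] ([q]-at-F G + (if q G then multF part G 𝓕 else 0))
      ≡⟨ ∑-cong (allSubsets N) (λ {G} _ → add-F G) ⟩
    ∑[ G ← allSubsets N ] (if q G then multF part G (F ∷ 𝓕) else 0) ∎
    where
    open ≡-Reasoning
    [q] [q]-at-F : Subset N → ℕ
    [q] G = if q G then 1 else 0
    [q]-at-F G = if ⌊ G ≟ˢ F ⌋ then [q] G else 0
    length-filterᵇ-∷ : length (filterᵇ q (F ∷ 𝓕)) ≡ [q] F + length (filterᵇ q 𝓕)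
    length-filterᵇ-∷ with q F
    ... | true  = refl
    ... | false = refl
    add-F : ∀ G → [q]-at-F G + (if q G then multF part G 𝓕 else 0) ≡ (if q G then multF part G (F ∷ 𝓕) else 0)
    add-F G rewrite multF-∷ F G 𝓕 with G ≟ˢ F | F ≟ˢ G | q G
    ... | yes refl | yes _   | true  = refl
    ... | yes refl | yes _   | false = refl
    ... | yes refl | no F≢F  | _     = ⊥-elim (F≢F refl)
    ... | no G≢F   | yes F≡G | _     = ⊥-elim (G≢F (sym F≡G))
    ... | no _     | no _    | true  = refl
    ... | no _     | no _    | false = refl

  profileCount : MultiFamily part → πM part → ℕ
  profileCount 𝓕 v = length (filterᵇ (λ F → hasProfile part F v) 𝓕)

  maxMult : MultiFamily part → πM part → ℕ
  maxMult 𝓕 v = maxℕ (map (λ F → if hasProfile part F v then multF part F 𝓕 else 0) (allSubsets N))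

  multF≤maxMult : ∀ 𝓕 {v} G → T (hasProfile part G v) → multF part G 𝓕 ≤ maxMult 𝓕 v
  multF≤maxMult 𝓕 {v} G hp = subst (_≤ maxMult 𝓕 v) (if-T hp)
    (maxℕ-≥ (λ F → if hasProfile part F v then multF part F 𝓕 else 0) (∈-allSubsets G))

  maxMult-≤ : ∀ 𝓕 {v K} → (∀ {G} → T (hasProfile part G v) → multF part G 𝓕 ≤ K) → maxMult 𝓕 v ≤ K
  maxMult-≤ 𝓕 {v} {K} bound = maxℕ-≤ _ {allSubsets N} (λ {G} _ → bounded G)
    where
    bounded : ∀ G → (if hasProfile part G v then multF part G 𝓕 else 0) ≤ K
    bounded G with hasProfile part G v | bound {G}
    ... | true  | ≤K = ≤K tt
    ... | false | _  = z≤n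

  private
    termwise-≤ : ∀ 𝓕 {v K} → maxMult 𝓕 v ≤ K → ∀ G →
      (if hasProfile part G v then multF part G 𝓕 else 0) ≤ (if hasProfile part G v then K else 0)
    termwise-≤ 𝓕 {v} max≤K G with hasProfile part G v in hp
    ... | true  = ℕ.≤-trans (multF≤maxMult 𝓕 G (Equivalence.from T-≡ hp)) max≤K
    ... | false = z≤n

  profileCount-≤ : ∀ 𝓕 {v K} → maxMult 𝓕 v ≤ K → profileCount 𝓕 v ≤ K * classSize v
  profileCount-≤ 𝓕 {v} {K} max≤K = begin
    profileCount 𝓕 v
      ≡⟨ length-filterᵇ≡∑multF _ 𝓕 ⟩
    ∑[ G ← allSubsets N ] (if hasProfile part G v then multF part G 𝓕 else 0)
      ≤⟨ ∑-mono (allSubsets N) (λ {G} _ → termwise-≤ 𝓕 max≤K G) ⟩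
    ∑[ G ← allSubsets N ] (if hasProfile part G v then K else 0)
      ≡⟨ ∑-hasProfile v K ⟩
    K * classSize v ∎
    where open ℕ.≤-Reasoning

  profileCount-≡⇒multF≡ : ∀ 𝓕 {v K} → maxMult 𝓕 v ≤ K → profileCount 𝓕 v ≡ K * classSize v →
                          ∀ {G} → T (hasProfile part G v) → multF part G 𝓕 ≡ K
  profileCount-≡⇒multF≡ 𝓕 {v} {K} max≤K count≡ {G} hp =
    trans (sym (if-T hp)) (trans (termwise-≡ (∈-allSubsets G)) (if-T hp))
    where
    termwise-≡ : ∀ {G} → G ∈ allSubsets N →
                 (if hasProfile part G v then multF part G 𝓕 else 0) ≡ (if hasProfile part G v then K else 0)
    termwise-≡ = ∑-≤-≡ (allSubsets N) (λ {G} _ → termwise-≤ 𝓕 max≤K G)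
                   (trans (sym (length-filterᵇ≡∑multF _ 𝓕)) (trans count≡ (sym (∑-hasProfile v K))))

  realise : MultiSet part → MultiFamily part
  realise I = concatMap (λ G → replicate (I (profile G)) G) (allSubsets N)

  length-filterᵇ-realise : ∀ I (q : Subset N → Bool) →
    length (filterᵇ q (realise I)) ≡ ∑[ G ← allSubsets N ] (if q G then I (profile G) else 0)
  length-filterᵇ-realise I q = begin
    length (filterᵇ q (realise I))
      ≡⟨ length-filterᵇ q (realise I) ⟩
    ∑[ F ← realise I ] (if q F then 1 else 0)
      ≡⟨ ∑-concatMap _ (allSubsets N) _ ⟩
    ∑[ G ← allSubsets N ] ∑[ F ← replicate (I (profile G)) G ] (if q F then 1 else 0)
      ≡⟨ ∑-cong (allSubsets N) (λ {G} _ → trans (∑-replicate (I (profile G)) G _) (*-indicator (q G) _)) ⟩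
    ∑[ G ← allSubsets N ] (if q G then I (profile G) else 0) ∎
    where open ≡-Reasoning

  multF-realise : ∀ I G → multF part G (realise I) ≡ I (profile G)
  multF-realise I G = trans (length-filterᵇ-realise I (λ H → H ==ˢ G))
    (∑-indicator _≟ˢ_ (allSubsets N) (allSubsets-unique N) (∈-allSubsets G) (I ∘ profile))

  maxMult-realise : ∀ I v → maxMult (realise I) v ≤ I v
  maxMult-realise I v = maxMult-≤ (realise I)
    (λ {G} hp → ℕ.≤-reflexive (trans (multF-realise I G) (cong I (hasProfile⇒≡ G hp))))

  profileCount-realise : ∀ I v → profileCount (realise I) v ≡ I v * classSize v
  profileCount-realise I v = begin
    profileCount (realise I) v
      ≡⟨ length-filterᵇ-realise I _ ⟩
    ∑[ G ← allSubsets N ] (if hasProfile part G v then I (profile G) else 0)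
      ≡⟨ ∑-cong (allSubsets N) (λ {G} _ → on-class G) ⟩
    ∑[ G ← allSubsets N ] (if hasProfile part G v then I v else 0)
      ≡⟨ ∑-hasProfile v (I v) ⟩
    I v * classSize v ∎
    where
    open ≡-Reasoning
    on-class : ∀ G → (if hasProfile part G v then I (profile G) else 0) ≡ (if hasProfile part G v then I v else 0)
    on-class G with hasProfile part G v in hp
    ... | true  = cong I (hasProfile⇒≡ G (Equivalence.from T-≡ hp))
    ... | false = refl

  -- In each block X j, a maximal chain through F₀ ∩ X j.
  module FullChain (F₀ : Subset N) where

    chain : Fin M → ℕ → Subset N
    chain j s = initialSegment s (F₀ ∩ X j) ∪ initialSegment (s ∸ ∣ F₀ ∩ X j ∣) (∁ F₀ ∩ X j)

    chain-⊆ : ∀ j s → chain j s ⊆ X j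
    chain-⊆ j s = ∪-⊆ (λ x∈ → p∩q⊆q F₀ (X j) (initialSegment-⊆ s _ x∈))
                      (λ x∈ → p∩q⊆q (∁ F₀) (X j) (initialSegment-⊆ (s ∸ ∣ F₀ ∩ X j ∣) _ x∈))

    chain-mono : ∀ j {s s′} → s ≤ s′ → chain j s ⊆ chain j s′
    chain-mono j s≤s′ = ∪-mono-⊆ (initialSegment-mono (F₀ ∩ X j) s≤s′)
                                 (initialSegment-mono (∁ F₀ ∩ X j) (ℕ.∸-monoˡ-≤ ∣ F₀ ∩ X j ∣ s≤s′))

    ∣chain∣ : ∀ j {s} → s ≤ m j → ∣ chain j s ∣ ≡ s
    ∣chain∣ j {s} s≤m = begin
      ∣ chain j s ∣
        ≡⟨ ∣p∪q∣≡∣p∣+∣q∣ _ _ disjoint ⟩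
      ∣ initialSegment s Y ∣ + ∣ initialSegment (s ∸ ∣ Y ∣) Z ∣
        ≡⟨ cong₂ _+_ (∣initialSegment∣ s Y) (∣initialSegment∣ _ Z) ⟩
      s ⊓ ∣ Y ∣ + (s ∸ ∣ Y ∣) ⊓ ∣ Z ∣
        ≡⟨ s⊓a+[s∸a]⊓b≡s ∣ Y ∣ ∣ Z ∣ (subst (s ≤_) (sym (∣p∩q∣+∣∁p∩q∣≡∣q∣ F₀ (X j))) s≤m) ⟩
      s ∎
      where
      open ≡-Reasoning
      Y Z : Subset N
      Y = F₀ ∩ X j
      Z = ∁ F₀ ∩ X j
      disjoint : ∀ {x} → x ∈ˢ initialSegment s Y → x ∉ˢ initialSegment (s ∸ ∣ Y ∣) Z
      disjoint x∈Y x∈Z = x∈p⇒x∉∁p (proj₁ (x∈p∩q⁻ F₀ _ (initialSegment-⊆ s Y x∈Y)))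
                                  (proj₁ (x∈p∩q⁻ (∁ F₀) _ (initialSegment-⊆ (s ∸ ∣ Y ∣) Z x∈Z)))

    chain-through-F₀ : ∀ j → chain j ∣ F₀ ∩ X j ∣ ≡ F₀ ∩ X j
    chain-through-F₀ j rewrite initialSegment-all _ (F₀ ∩ X j) ℕ.≤-refl | ℕ.n∸n≡0 ∣ F₀ ∩ X j ∣ = ∪-identityʳ _

    chainSet : πM part → Subset N
    chainSet v = glue (λ j → chain j (toℕ (coord v j)))

    chainSet-∩-block : ∀ v j → chainSet v ∩ X j ≡ chain j (toℕ (coord v j))
    chainSet-∩-block v = glue-∩-block (λ j → chain-⊆ j _)

    hasProfile-chainSet : ∀ v → T (hasProfile part (chainSet v) v)
    hasProfile-chainSet v = hasProfile⁺ (chainSet v) (λ i →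
      trans (cong ∣_∣ (chainSet-∩-block v i)) (∣chain∣ i (ℕ.≤-pred (Fin.toℕ<n (coord v i)))))

    chainSet-injective : ∀ {v w} → chainSet v ≡ chainSet w → v ≡ w
    chainSet-injective {v} {w} eq = trans (sym (hasProfile⇒≡ (chainSet v) (hasProfile-chainSet v)))
      (trans (cong profile eq) (hasProfile⇒≡ (chainSet w) (hasProfile-chainSet w)))

    chainSet-profile : chainSet (profile F₀) ≡ F₀
    chainSet-profile = ∩-block-injective (λ j → begin
      chainSet (profile F₀) ∩ X j          ≡⟨ chainSet-∩-block (profile F₀) j ⟩
      chain j (toℕ (coord (profile F₀) j)) ≡⟨ cong (chain j) (toℕ-sizesOf (λ _ → F₀) j) ⟩
      chain j ∣ F₀ ∩ X j ∣                 ≡⟨ chain-through-F₀ j ⟩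
      F₀ ∩ X j                             ∎)
      where open ≡-Reasoning

  maxMult-attained : ∀ 𝓕 v → ∃ λ G → T (hasProfile part G v) × maxMult 𝓕 v ≤ multF part G 𝓕
  maxMult-attained 𝓕 v = [ fallback , attained ]′ (maxℕ-attained term (allSubsets N))
    where
    open FullChain ⊥ using (chainSet; hasProfile-chainSet)
    term : Subset N → ℕ
    term F = if hasProfile part F v then multF part F 𝓕 else 0
    Goal : Set
    Goal = ∃ λ G → T (hasProfile part G v) × maxMult 𝓕 v ≤ multF part G 𝓕
    fallback : maxMult 𝓕 v ≡ 0 → Goal
    fallback max≡0 = chainSet v , hasProfile-chainSet v , subst (_≤ multF part (chainSet v) 𝓕) (sym max≡0) z≤n
    attained : (∃ λ G → G ∈ allSubsets N × maxMult 𝓕 v ≡ term G) → Goal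
    attained (G , _ , max≡) with hasProfile part G v in hp
    ... | true  = G , Equivalence.from T-≡ hp , ℕ.≤-reflexive max≡
    ... | false = fallback max≡

  -- Sperner multi-families and multi-transversals

  matches : Subset M → (Fin M → List (Subset N)) → (Fin M → Subset N) → Subset N → Bool
  matches P 𝒞 D F =
    all (λ j → if lookup P j then any (λ Y → (F ∩ X j) ==ˢ Y) (𝒞 j) else (F ∩ X j) ==ˢ D j) (allFin M)

  agreesOff : Subset M → πM part → πM part → Bool
  agreesOff P b v = all (λ j → if lookup P j then true else ⌊ coord v j Fin.≟ coord b j ⌋) (allFin M)

  module Pattern (P : Subset M) (𝒞 : Fin M → List (Subset N)) (D : Fin M → Subset N) (F : Subset N) where

    private
      Condition : Fin M → Bool
      Condition j = if lookup P j then any (λ Y → (F ∩ X j) ==ˢ Y) (𝒞 j) else (F ∩ X j) ==ˢ D j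

      matches-at : T (matches P 𝒞 D F) → ∀ j → T (Condition j)
      matches-at m j = All.lookup (AllP.all⁺ _ (allFin M) m) (∈.∈-allFin j)

    matches⁺ : (∀ j → lookup P j ≡ true → F ∩ X j ∈ 𝒞 j) → (∀ j → lookup P j ≡ false → F ∩ X j ≡ D j) →
               T (matches P 𝒞 D F)
    matches⁺ in-𝒞 is-D = AllP.all⁻ _ (All.universal at (allFin M))
      where
      at : ∀ j → T (Condition j)
      at j with lookup P j | in-𝒞 j | is-D j
      ... | true  | ∈𝒞 | _  = AnyP.any⁺ _ (Any.map fromWitness (∈𝒞 refl))
      ... | false | _  | ≡D = fromWitness (≡D refl)

    matches⁻-in : T (matches P 𝒞 D F) → ∀ {j} → lookup P j ≡ true → F ∩ X j ∈ 𝒞 j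
    matches⁻-in m {j} Pj =
      Any.map toWitness (AnyP.any⁻ _ (𝒞 j) (subst (λ c → T (if c then _ else _)) Pj (matches-at m j)))

    matches⁻-out : T (matches P 𝒞 D F) → ∀ {j} → lookup P j ≡ false → F ∩ X j ≡ D j
    matches⁻-out m {j} ¬Pj = toWitness (subst (λ c → T (if c then _ else _)) ¬Pj (matches-at m j))

  agreesOff⁺ : ∀ {P b} v → (∀ j → lookup P j ≡ false → coord v j ≡ coord b j) → T (agreesOff P b v)
  agreesOff⁺ {P} {b} v agree = AllP.all⁻ _ (All.universal at (allFin M))
    where
    at : ∀ j → T (if lookup P j then true else ⌊ coord v j Fin.≟ coord b j ⌋)
    at j with lookup P j | agree j
    ... | true  | _   = tt
    ... | false | v≡b = fromWitness (v≡b refl)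

  agreesOff⁻ : ∀ {P b} v → T (agreesOff P b v) → ∀ {j} → lookup P j ≡ false → coord v j ≡ coord b j
  agreesOff⁻ {P} {b} v agree {j} ¬Pj =
    toWitness (subst (λ c → T (if c then true else _)) ¬Pj
                     (All.lookup (AllP.all⁺ _ (allFin M) agree) (∈.∈-allFin j)))

  -- chainSet embeds the vectors agreeing with b off P into the sets matching the pattern of the
  -- full chains through F₀ (on P) and of their members of sizes b (off P).
  sperner⇒transversal : ∀ {k L 𝓕} → IsSperner part k L 𝓕 → ∀ F₀ (J : MultiSet part) →
    (∀ v → J v ≤ multF part (FullChain.chainSet F₀ v) 𝓕) → IsMultiTransversal part k L J
  sperner⇒transversal {k} {L} {𝓕} sperner F₀ J J≤ P P-k b = begin
    ∑[ v ← allπM part ] (if agreesOff P b v then J v else 0)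
      ≤⟨ ∑-≤-reindex _≟ˢ_ chainSet allπM-unique (allSubsets-unique N) ∈-allSubsets termwise
                     (λ _ _ _ _ → chainSet-injective) ⟩
    ∑[ G ← allSubsets N ] (if matches P 𝒞 D G then multF part G 𝓕 else 0)
      ≡⟨ length-filterᵇ≡∑multF (matches P 𝒞 D) 𝓕 ⟨
    length (filterᵇ (matches P 𝒞 D) 𝓕)
      ≤⟨ sperner P P-k 𝒞 𝒞-chains D (λ i _ → chain-⊆ i _) ⟩
    L P ∎
    where
    open ℕ.≤-Reasoning
    open FullChain F₀
    𝒞 : Fin M → List (Subset N)
    𝒞 j = applyUpTo (chain j) (suc (m j))
    D : Fin M → Subset N
    D i = chain i (toℕ (coord b i))
    open Pattern P 𝒞 D
    𝒞-chains : ∀ j → lookup P j ≡ true → IsChainIn part j (𝒞 j)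
    𝒞-chains j _ =
      AllP.applyUpTo⁺₂ (chain j) _ (chain-⊆ j) ,
      AllPairs.applyUpTo⁺₂ (chain j) _ (λ s s′ → Sum.map (chain-mono j) (chain-mono j) (ℕ.≤-total s s′))
    chainSet-matches : ∀ v → T (agreesOff P b v) → T (matches P 𝒞 D (chainSet v))
    chainSet-matches v agree = matches⁺ (chainSet v)
      (λ j _ → subst (_∈ 𝒞 j) (sym (chainSet-∩-block v j)) (∈.∈-applyUpTo⁺ (chain j) (Fin.toℕ<n (coord v j))))
      (λ j ¬Pj → trans (chainSet-∩-block v j) (cong (chain j ∘ toℕ) (agreesOff⁻ {P} {b} v agree ¬Pj)))
    termwise : ∀ {v} → v ∈ allπM part →
      (if agreesOff P b v then J v else 0) ≤ (if matches P 𝒞 D (chainSet v) then multF part (chainSet v) 𝓕 else 0)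
    termwise {v} _ with agreesOff P b v in agree
    ... | false = z≤n
    ... | true rewrite Equivalence.to T-≡ (chainSet-matches v (Equivalence.from T-≡ agree)) = J≤ v

  -- Sets matching a Sperner pattern are determined by their profiles, which agree with sizesOf D off P.
  realise-sperner : ∀ {k L I} → IsMultiTransversal part k L I → IsSperner part k L (realise I)
  realise-sperner {k} {L} {I} transversal P P-k 𝒞 𝒞-chains D D⊆X = begin
    length (filterᵇ (matches P 𝒞 D) (realise I))
      ≡⟨ length-filterᵇ-realise I (matches P 𝒞 D) ⟩
    ∑[ G ← allSubsets N ] (if matches P 𝒞 D G then I (profile G) else 0)
      ≤⟨ ∑-≤-reindex _≟π_ profile (allSubsets-unique N) allπM-unique ∈-allπM termwise injective ⟩
    ∑[ v ← allπM part ] (if agreesOff P b v then I v else 0)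
      ≤⟨ transversal P P-k b ⟩
    L P ∎
    where
    open ℕ.≤-Reasoning
    b : πM part
    b = sizesOf D
    open Pattern P 𝒞 D
    D∩X≡D : ∀ {j} → lookup P j ≡ false → D j ∩ X j ≡ D j
    D∩X≡D {j} ¬Pj = ⊆-antisym (p∩q⊆p (D j) (X j)) (λ x∈ → x∈p∩q⁺ (x∈ , D⊆X j ¬Pj x∈))
    profile-agrees : ∀ {G} → T (matches P 𝒞 D G) → T (agreesOff P b (profile G))
    profile-agrees {G} m = agreesOff⁺ {P} {b} (profile G) (λ j ¬Pj → Fin.toℕ-injective (begin-equality
      toℕ (coord (profile G) j) ≡⟨ toℕ-sizesOf (λ _ → G) j ⟩
      ∣ G ∩ X j ∣               ≡⟨ cong ∣_∣ (matches⁻-out G m ¬Pj) ⟩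
      ∣ D j ∣                   ≡⟨ cong ∣_∣ (D∩X≡D ¬Pj) ⟨
      ∣ D j ∩ X j ∣             ≡⟨ toℕ-sizesOf D j ⟨
      toℕ (coord b j)           ∎))
    termwise : ∀ {G} → G ∈ allSubsets N →
      (if matches P 𝒞 D G then I (profile G) else 0) ≤ (if agreesOff P b (profile G) then I (profile G) else 0)
    termwise {G} _ with matches P 𝒞 D G in mG
    ... | false = z≤n
    ... | true rewrite Equivalence.to T-≡ (profile-agrees (Equivalence.from T-≡ mG)) = ℕ.≤-refl
    same-blocks : ∀ {G G′} → T (matches P 𝒞 D G) → T (matches P 𝒞 D G′) → profile G ≡ profile G′ →
                  ∀ j → G ∩ X j ≡ G′ ∩ X j
    same-blocks {G} {G′} m m′ same j with lookup P j in Pj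
    ... | false = trans (matches⁻-out G m Pj) (sym (matches⁻-out G′ m′ Pj))
    ... | true  = comparable∧∣≡∣⇒≡ (AllPairs-lookup (inj₁ (λ {x} x∈ → x∈)) Sum.swap (proj₂ (𝒞-chains j Pj))
                                                    (matches⁻-in G m Pj) (matches⁻-in G′ m′ Pj))
                                  (profile≡⇒∣∩X∣≡ {G} {G′} same j)
    injective : ∀ {G G′} → G ∈ allSubsets N → G′ ∈ allSubsets N →
                0 < (if matches P 𝒞 D G then I (profile G) else 0) →
                0 < (if matches P 𝒞 D G′ then I (profile G′) else 0) → profile G ≡ profile G′ → G ≡ G′
    injective {G} {G′} _ _ pos pos′ same =
      ∩-block-injective (same-blocks (positive-if (matches P 𝒞 D G) pos) (positive-if (matches P 𝒞 D G′) pos′) same)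

  weightedSum-mono : ∀ {G} (α : Fin G → πM part → ℚ) → (∀ γ v → 0ℚ ≤ℚ α γ v) → ∀ {J J′ : MultiSet part} →
    (∀ v → J v ≤ J′ v) →
    ∀ γ → ∑ℚ[ v ← allπM part ] (α γ v ℚ.* ℕtoℚ (J v)) ≤ℚ ∑ℚ[ v ← allπM part ] (α γ v ℚ.* ℕtoℚ (J′ v))
  weightedSum-mono α α≥0 J≤J′ γ = ∑ℚ-mono (allπM part)
    (λ {v} _ → ℚ.*-monoˡ-≤-nonNeg (α γ v) {{ℚ.nonNegative (α≥0 γ v)}} (ℕtoℚ-mono-≤ (J≤J′ v)))

  SMatrix∈μ𝔄 : ∀ {k L G} {A : Fin G → ℚ} {α : Fin G → πM part → ℚ} → (∀ γ v → 0ℚ ≤ℚ α γ v) →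
    ∀ {I} → IsMultiTransversal part k L I → SatisfiesMS part A α I → Inμ𝔄 part k L A α (SMatrix part I)
  SMatrix∈μ𝔄 {α = α} α≥0 {I} transversal satisfies =
    realise I ,
    (realise-sperner transversal , λ γ → ℚ.≤-trans (weightedSum-mono α α≥0 (maxMult-realise I) γ) (satisfies γ)) ,
    λ v → cong ℕtoℚ (sym (profileCount-realise I v))

  -- Convex combinations

  ∈⇒∈ConvHull : ∀ {S : Matrix part → Set} {p} → S p → InConvHull part S p
  ∈⇒∈ConvHull {p = p} p∈S =
    (1ℚ , p) ∷ [] , (ℚ.nonNegative⁻¹ 1ℚ , p∈S) ∷ [] , ℚ.+-identityʳ 1ℚ ,
    λ v → sym (trans (ℚ.+-identityʳ _) (ℚ.*-identityˡ (p v)))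

  combination : List (ℚ × Matrix part) → Matrix part
  combination cs u = ∑ℚ[ c ← cs ] (proj₁ c ℚ.* proj₂ c u)

  combination-of-constant : ∀ (cs : List (ℚ × Matrix part)) {p : Matrix part} →
    (∀ {c} → c ∈ cs → 0ℚ ≤ℚ proj₁ c) → ∑ℚ cs proj₁ ≡ 1ℚ →
    (∀ {c} → c ∈ cs → 0ℚ <ℚ proj₁ c → ∀ u → proj₂ c u ≡ p u) → ∀ u → combination cs u ≡ p u
  combination-of-constant cs {p} w≥0 ∑w≡1 members≡p u = begin
    combination cs u               ≡⟨ ∑ℚ-cong cs (λ c∈ → at c∈ (0≤⇒0≡∨0< (w≥0 c∈))) ⟩
    ∑ℚ[ c ← cs ] (proj₁ c ℚ.* p u) ≡⟨ ∑ℚ-weighted-constant cs proj₁ ∑w≡1 (p u) ⟩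
    p u                            ∎
    where
    open ≡-Reasoning
    at : ∀ {c} → c ∈ cs → proj₁ c ≡ 0ℚ ⊎ 0ℚ <ℚ proj₁ c → proj₁ c ℚ.* proj₂ c u ≡ proj₁ c ℚ.* p u
    at {_ , q} _  (inj₁ refl) = trans (ℚ.*-zeroˡ (q u)) (sym (ℚ.*-zeroˡ (p u)))
    at {w , _} c∈ (inj₂ 0<w)  = cong (w ℚ.*_) (members≡p c∈ 0<w u)

  scale : ℚ → ℚ × Matrix part → ℚ × Matrix part
  scale r (w , q) = r ℚ.* w , q

  mix : ℚ → List (ℚ × Matrix part) → List (ℚ × Matrix part) → List (ℚ × Matrix part)
  mix t csa csb = map (scale t) csa ++ map (scale (1ℚ ℚ.- t)) csb

  private
    ∑-scale : ∀ r cs (f : ℚ × Matrix part → ℚ) → (∀ w q → f (r ℚ.* w , q) ≡ r ℚ.* f (w , q)) →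
              ∑ℚ (map (scale r) cs) f ≡ r ℚ.* ∑ℚ cs f
    ∑-scale r cs f f-scale =
      trans (∑ℚ-map (scale r) cs f) (trans (∑ℚ-cong cs (λ {(w , q)} _ → f-scale w q)) (∑ℚ-*ˡ cs r f))

  mix-members : ∀ {S : Matrix part → Set} {t csa csb} → 0ℚ <ℚ t → t <ℚ 1ℚ →
    All (λ c → 0ℚ ≤ℚ proj₁ c × S (proj₂ c)) csa → All (λ c → 0ℚ ≤ℚ proj₁ c × S (proj₂ c)) csb →
    All (λ c → 0ℚ ≤ℚ proj₁ c × S (proj₂ c)) (mix t csa csb)
  mix-members {S} 0<t t<1 members-a members-b =
    AllP.++⁺ (scale-members (ℚ.<⇒≤ 0<t) members-a) (scale-members (ℚ.<⇒≤ (0<1-t t<1)) members-b)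
    where
    scale-members : ∀ {r} → 0ℚ ≤ℚ r → ∀ {cs} → All (λ c → 0ℚ ≤ℚ proj₁ c × S (proj₂ c)) cs →
                    All (λ c → 0ℚ ≤ℚ proj₁ c × S (proj₂ c)) (map (scale r) cs)
    scale-members 0≤r = AllP.map⁺ ∘ All.map (λ { {w , _} (0≤w , q∈S) → nonNeg*nonNeg 0≤r 0≤w , q∈S })

  mix-weights : ∀ t {csa csb} → ∑ℚ csa proj₁ ≡ 1ℚ → ∑ℚ csb proj₁ ≡ 1ℚ → ∑ℚ (mix t csa csb) proj₁ ≡ 1ℚ
  mix-weights t {csa} {csb} ∑a≡1 ∑b≡1 = begin
    ∑ℚ (mix t csa csb) proj₁
      ≡⟨ ∑ℚ-++ (map (scale t) csa) _ proj₁ ⟩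
    ∑ℚ (map (scale t) csa) proj₁ ℚ.+ ∑ℚ (map (scale (1ℚ ℚ.- t)) csb) proj₁
      ≡⟨ cong₂ ℚ._+_ (∑-scale t csa proj₁ (λ _ _ → refl)) (∑-scale (1ℚ ℚ.- t) csb proj₁ (λ _ _ → refl)) ⟩
    t ℚ.* ∑ℚ csa proj₁ ℚ.+ (1ℚ ℚ.- t) ℚ.* ∑ℚ csb proj₁
      ≡⟨ cong₂ (λ x y → t ℚ.* x ℚ.+ (1ℚ ℚ.- t) ℚ.* y) ∑a≡1 ∑b≡1 ⟩
    t ℚ.* 1ℚ ℚ.+ (1ℚ ℚ.- t) ℚ.* 1ℚ
      ≡⟨ solve 1 (λ t → t :* con 1ℚ :+ (con 1ℚ :- t) :* con 1ℚ := con 1ℚ) refl t ⟩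
    1ℚ ∎
    where
    open ≡-Reasoning
    open ℚ-Solver

  combination-mix : ∀ t csa csb u →
    combination (mix t csa csb) u ≡ t ℚ.* combination csa u ℚ.+ (1ℚ ℚ.- t) ℚ.* combination csb u
  combination-mix t csa csb u = trans (∑ℚ-++ (map (scale t) csa) _ _)
    (cong₂ ℚ._+_ (∑-scale t csa _ (λ w q → ℚ.*-assoc t w (q u)))
                 (∑-scale (1ℚ ℚ.- t) csb _ (λ w q → ℚ.*-assoc (1ℚ ℚ.- t) w (q u))))

  record LexMaximal (S : Matrix part → Set) (p : Matrix part) : Set where
    field
      order           : List (πM part)
      bounded-along   : ∀ {q} → S q → ∀ {pre j post} → order ≡ pre ++ j ∷ post →
                        All (λ u → q u ≡ p u) pre → q j ≤ℚ p j
      bounded-outside : ∀ {q} → S q → ∀ {u} → u ∉ order → p u ≤ℚ q u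

  module _ {S : Matrix part → Set} {p : Matrix part} (lexMax : LexMaximal S p) where

    open LexMaximal lexMax

    -- Going along the order, weighted-∑-≤-≡ shows position by position that the members of positive
    -- weight agree with p.
    lexMaximal-members : ∀ cs → All (λ c → 0ℚ ≤ℚ proj₁ c × S (proj₂ c)) cs → ∑ℚ cs proj₁ ≡ 1ℚ →
      (∀ u → p u ≡ combination cs u) → ∀ {c} → c ∈ cs → 0ℚ <ℚ proj₁ c → ∀ u → proj₂ c u ≡ p u
    lexMaximal-members cs members ∑w≡1 p≡ {c} c∈ 0<w u with u ∈? order
    ... | yes u∈ = All.lookup (agree-along {[]} refl (λ _ _ → []) c∈ 0<w) u∈
      where
      Agree : List (πM part) → Set
      Agree pre = ∀ {c} → c ∈ cs → 0ℚ <ℚ proj₁ c → All (λ u → proj₂ c u ≡ p u) pre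
      agree-along : ∀ {pre rest} → order ≡ pre ++ rest → Agree pre → Agree order
      agree-along {pre} {[]}       split agree = subst Agree (sym (trans split (++-identityʳ pre))) agree
      agree-along {pre} {j ∷ rest} split agree = agree-along (trans split (sym (++-assoc pre (j ∷ []) rest)))
                                                   (λ c∈ 0<w → AllP.++⁺ (agree c∈ 0<w) (at-j c∈ 0<w ∷ []))
        where
        at-j : ∀ {c} → c ∈ cs → 0ℚ <ℚ proj₁ c → proj₂ c j ≡ p j
        at-j = weighted-∑-≤-≡ cs proj₁ (λ c → proj₂ c j) (λ _ → p j) (proj₁ ∘ All.lookup members)
                 (λ c∈ 0<w → bounded-along (proj₂ (All.lookup members c∈)) split (agree c∈ 0<w))
                 (trans (sym (p≡ j)) (sym (∑ℚ-weighted-constant cs proj₁ ∑w≡1 (p j))))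
    ... | no u∉ = sym (weighted-∑-≤-≡ cs proj₁ (λ _ → p u) (λ c → proj₂ c u) (proj₁ ∘ All.lookup members)
                    (λ c∈ _ → bounded-outside (proj₂ (All.lookup members c∈)) u∉)
                    (trans (∑ℚ-weighted-constant cs proj₁ ∑w≡1 (p u)) (p≡ u)) c∈ 0<w)

    -- If p = t a + (1 - t) b, then p is represented by the mixture of the combinations representing
    -- a and b, whose members of positive weight therefore all equal p; hence a = p = b.
    lexMaximal⇒extreme : InConvHull part S p → IsExtremePoint part S p
    lexMaximal⇒extreme p∈ = p∈ , extreme
      where
      extreme : ∀ a b t → InConvHull part S a → InConvHull part S b → 0ℚ <ℚ t → t <ℚ 1ℚ →
                (∀ v → p v ≡ t ℚ.* a v ℚ.+ (1ℚ ℚ.- t) ℚ.* b v) → ∀ v → a v ≡ b v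
      extreme a b t (csa , members-a , ∑a≡1 , a≡) (csb , members-b , ∑b≡1 , b≡) 0<t t<1 p≡ v =
        trans (trans (a≡ v) (a≡p v)) (sym (trans (b≡ v) (b≡p v)))
        where
        cs : List (ℚ × Matrix part)
        cs = mix t csa csb
        p≡combination : ∀ u → p u ≡ combination cs u
        p≡combination u = trans (p≡ u) (trans (cong₂ (λ x y → t ℚ.* x ℚ.+ (1ℚ ℚ.- t) ℚ.* y) (a≡ u) (b≡ u))
                                              (sym (combination-mix t csa csb u)))
        member≡p : ∀ {c} → c ∈ cs → 0ℚ <ℚ proj₁ c → ∀ u → proj₂ c u ≡ p u
        member≡p = lexMaximal-members cs (mix-members 0<t t<1 members-a members-b)
                                      (mix-weights t {csa} {csb} ∑a≡1 ∑b≡1) p≡combination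
        a≡p : ∀ u → combination csa u ≡ p u
        a≡p = combination-of-constant csa (proj₁ ∘ All.lookup members-a) ∑a≡1 (λ c∈ 0<w →
          member≡p (∈.∈-++⁺ˡ (∈.∈-map⁺ (scale t) c∈)) (pos*pos 0<t 0<w))
        b≡p : ∀ u → combination csb u ≡ p u
        b≡p = combination-of-constant csb (proj₁ ∘ All.lookup members-b) ∑b≡1 (λ c∈ 0<w →
          member≡p (∈.∈-++⁺ʳ (map (scale t) csa) (∈.∈-map⁺ (scale (1ℚ ℚ.- t)) c∈)) (pos*pos (0<1-t t<1) 0<w))

  -- Lexicographically maximal multi-transversals

  module LexBound {k L G} {A : Fin G → ℚ} {α : Fin G → πM part → ℚ} (α≥0 : ∀ γ v → 0ℚ ≤ℚ α γ v)
                  {I : MultiSet part} (lem : IsLEM part k L A α I) where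

    order : List (πM part)
    order = proj₁ lem

    private
      order-unique : Unique order
      order-unique = proj₁ (proj₂ lem)

      order⊆supp : ∀ {v} → v ∈ order → InSupp part I v
      order⊆supp {v} = proj₁ (proj₁ (proj₂ (proj₂ lem)) v)

      supp⊆order : ∀ {v} → InSupp part I v → v ∈ order
      supp⊆order {v} = proj₂ (proj₁ (proj₂ (proj₂ lem)) v)

      lem-ii : ∀ J → IsMultiTransversal part k L J → SatisfiesMS part A α J → ∀ pre j post →
               order ≡ pre ++ j ∷ post → All (λ u → InSupp part J u × I u ≡ J u) pre → J j ≤ I j
      lem-ii J transversal satisfies = proj₂ (proj₂ (proj₂ (proj₂ lem)) J transversal satisfies)

    Saturated : MultiFamily part → πM part → Set
    Saturated 𝓕 u = ∀ F → T (hasProfile part F u) → multF part F 𝓕 ≡ I u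

    competitor : List (πM part) → πM part → ℕ → MultiSet part
    competitor pre j x v = if ⌊ v ∈? pre ⌋ then I v else if ⌊ v ≟π j ⌋ then x else 0

    competitor-≤ : ∀ {pre j x} {B : MultiSet part} → (∀ {u} → u ∈ pre → I u ≤ B u) → x ≤ B j →
                   ∀ v → competitor pre j x v ≤ B v
    competitor-≤ {pre} {j} I≤B x≤B v with v ∈? pre
    ... | yes v∈ = I≤B v∈
    ... | no  _  with v ≟π j
    ...   | yes refl = x≤B
    ...   | no  _    = z≤n

    competitor-pre : ∀ {pre j x u} → u ∈ pre → competitor pre j x u ≡ I u
    competitor-pre {pre} {u = u} u∈ with u ∈? pre
    ... | yes _  = refl
    ... | no  u∉ = ⊥-elim (u∉ u∈)

    competitor-at : ∀ {pre j x} → j ∉ pre → competitor pre j x j ≡ x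
    competitor-at {pre} {j} j∉ with j ∈? pre
    ... | yes j∈ = ⊥-elim (j∉ j∈)
    ... | no  _  with j ≟π j
    ...   | yes _   = refl
    ...   | no  j≢j = ⊥-elim (j≢j refl)

    -- The competitor with x = #[F₀, 𝓕] = maxMult 𝓕 j is bounded by the multiplicities of the sets
    -- chainSet F₀, so it is a multi-transversal, and by maxMult 𝓕, so it satisfies the constraint.
    lem-step : ∀ {𝓕} → In𝔄 part k L A α 𝓕 → ∀ {pre j post} → order ≡ pre ++ j ∷ post →
               All (Saturated 𝓕) pre → maxMult 𝓕 j ≤ I j
    lem-step {𝓕} (sperner , satisfiesMF) {pre} {j} {post} split saturated =
      subst (_≤ I j) (competitor-at j∉pre) (lem-ii I⋆ transversal satisfiesMS pre j post split agrees-on-pre)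
      where
      F₀ : Subset N
      F₀ = proj₁ (maxMult-attained 𝓕 j)
      F₀-has-j : T (hasProfile part F₀ j)
      F₀-has-j = proj₁ (proj₂ (maxMult-attained 𝓕 j))
      max≤multF₀ : maxMult 𝓕 j ≤ multF part F₀ 𝓕
      max≤multF₀ = proj₂ (proj₂ (maxMult-attained 𝓕 j))
      open FullChain F₀ using (chainSet; hasProfile-chainSet; chainSet-profile)
      I⋆ : MultiSet part
      I⋆ = competitor pre j (maxMult 𝓕 j)
      j∉pre : j ∉ pre
      j∉pre = Unique-middle pre post (subst Unique split order-unique)
      max≤mult-chainSet : maxMult 𝓕 j ≤ multF part (chainSet j) 𝓕
      max≤mult-chainSet = subst (λ F → maxMult 𝓕 j ≤ multF part F 𝓕)
        (sym (trans (cong chainSet (sym (hasProfile⇒≡ F₀ F₀-has-j))) chainSet-profile)) max≤multF₀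
      I≡mult-chainSet : ∀ {u} → u ∈ pre → I u ≡ multF part (chainSet u) 𝓕
      I≡mult-chainSet u∈ = sym (All.lookup saturated u∈ _ (hasProfile-chainSet _))
      transversal : IsMultiTransversal part k L I⋆
      transversal = sperner⇒transversal {𝓕 = 𝓕} sperner F₀ I⋆
        (competitor-≤ (ℕ.≤-reflexive ∘ I≡mult-chainSet) max≤mult-chainSet)
      satisfiesMS : SatisfiesMS part A α I⋆
      satisfiesMS γ = ℚ.≤-trans (weightedSum-mono α α≥0 I⋆≤max γ) (satisfiesMF γ)
        where
        I⋆≤max : ∀ v → I⋆ v ≤ maxMult 𝓕 v
        I⋆≤max = competitor-≤ (λ {u} u∈ → subst (_≤ maxMult 𝓕 u) (sym (I≡mult-chainSet u∈))
                                            (multF≤maxMult 𝓕 (chainSet u) (hasProfile-chainSet u))) ℕ.≤-refl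
      agrees-on-pre : All (λ u → InSupp part I⋆ u × I u ≡ I⋆ u) pre
      agrees-on-pre = All.tabulate (λ u∈ →
        subst (0 <_) (sym (competitor-pre u∈)) (order⊆supp (subst (_ ∈_) (sym split) (∈.∈-++⁺ˡ u∈))) ,
        sym (competitor-pre u∈))

    saturate : ∀ {𝓕} → In𝔄 part k L A α 𝓕 → ∀ {done rest post} → order ≡ done ++ rest ++ post →
               All (Saturated 𝓕) done → All (λ u → profileCount 𝓕 u ≡ I u * classSize u) rest →
               All (Saturated 𝓕) (done ++ rest)
    saturate {𝓕} in𝔄 {done} {[]} split saturated [] =
      subst (All (Saturated 𝓕)) (sym (++-identityʳ done)) saturated
    saturate {𝓕} in𝔄 {done} {u ∷ rest} {post} split saturated (count≡ ∷ counts≡) =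
      subst (All (Saturated 𝓕)) (++-assoc done (u ∷ []) rest)
        (saturate {𝓕} in𝔄 (trans split (sym (++-assoc done (u ∷ []) (rest ++ post))))
                  (AllP.++⁺ saturated (saturated-u ∷ [])) counts≡)
      where
      saturated-u : Saturated 𝓕 u
      saturated-u F = profileCount-≡⇒multF≡ 𝓕 (lem-step {𝓕} in𝔄 split saturated) count≡

    lexBound : ∀ {𝓕} → In𝔄 part k L A α 𝓕 → ∀ {pre j post} → order ≡ pre ++ j ∷ post →
               All (λ u → profileCount 𝓕 u ≡ I u * classSize u) pre → profileCount 𝓕 j ≤ I j * classSize j
    lexBound {𝓕} in𝔄 split counts≡ =
      profileCount-≤ 𝓕 (lem-step {𝓕} in𝔄 split (saturate {𝓕} in𝔄 {[]} split [] counts≡))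

    μ𝔄-lexMaximal : LexMaximal (Inμ𝔄 part k L A α) (SMatrix part I)
    μ𝔄-lexMaximal = record { order = order ; bounded-along = along ; bounded-outside = off-order }
      where
      along : ∀ {q} → Inμ𝔄 part k L A α q → ∀ {pre j post} → order ≡ pre ++ j ∷ post →
              All (λ u → q u ≡ SMatrix part I u) pre → q j ≤ℚ SMatrix part I j
      along {q} (𝓕 , in𝔄 , q≡) {pre} {j} split agree =
        subst (_≤ℚ SMatrix part I j) (sym (q≡ j)) (ℕtoℚ-mono-≤ (lexBound {𝓕} in𝔄 split counts≡))
        where
        counts≡ : All (λ u → profileCount 𝓕 u ≡ I u * classSize u) pre
        counts≡ = All.map (λ {u} q≡S → ℕtoℚ-injective (trans (sym (q≡ u)) q≡S)) agree
      off-order : ∀ {q} → Inμ𝔄 part k L A α q → ∀ {u} → u ∉ order → SMatrix part I u ≤ℚ q u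
      off-order {q} (𝓕 , _ , q≡) {u} u∉ = subst (SMatrix part I u ≤ℚ_) (sym (q≡ u)) (ℕtoℚ-mono-≤ Iu*c≤)
        where
        Iu*c≤ : I u * classSize u ≤ profileCount 𝓕 u
        Iu*c≤ rewrite ℕ.n≤0⇒n≡0 (ℕ.≮⇒≥ (u∉ ∘ supp⊆order)) = z≤n

lemma5p4 : (N M k : ℕ) (part : Fin N → Fin M) →
    ((i : Fin M) → 1 ≤ msize part i) →
    1 ≤ k → k ≤ M →
    (L : Subset M → ℕ) → ((P : Subset M) → IsKSet part k P → 0 < L P) →
    (G : ℕ) (A : Fin G → ℚ) (α : Fin G → πM part → ℚ) →
    ((γ : Fin G) → 0ℚ ≤ℚ A γ) → ((γ : Fin G) (v : πM part) → 0ℚ ≤ℚ α γ v) →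
    (I : MultiSet part) →
    IsMultiTransversal part k L I →
    SatisfiesMS part A α I →
    IsLEM part k L A α I →
    IsExtremePoint part (Inμ𝔄 part k L A α) (SMatrix part I)
lemma5p4 N M k part _ _ _ L _ G A α _ α≥0 I transversal satisfies lem =
  lexMaximal⇒extreme part (LexBound.μ𝔄-lexMaximal part α≥0 lem)
    (∈⇒∈ConvHull part (SMatrix∈μ𝔄 part α≥0 transversal satisfies))
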